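{- Let $W_n$ denote the total number of weak left to right maxima, summed over all Dyck paths of semi-length $n$, and let $\mathrm{WTot}=\sum_{n\ge1}W_n z^{2n}$. Then, with $u$ the power series in $z$ defined by $u=\frac{1-2z^2-\sqrt{1-4z^2}}{2z^2}$ (so that $z^2=\frac{u}{(1+u)^2}$), \[ \mathrm{WTot}=\sum_{r=1}^\infty \frac{(1-u)u^r(1-u^2)}{(1-u^{1+r})(1-u^{2+r})}\left(1-r+(1+u)\sum_{i=1}^r\frac{1-u^{1+i}}{1-u^{2+i}}\right). \]
   Context: A Dyck path of semi-length $n$ is a lattice path from $(0,0)$ to $(2n,0)$ with $n$ up steps $(1,1)$ and $n$ down steps $(1,-1)$ never going below the $x$-axis. A peak is an up step immediately followed by a down step, and its height is the height of its top point. A weak left to right maximum is a peak whose height is greater than or equal to the heights of all peaks to its left. -}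

module Defs where

open import Data.Nat as ℕ using (ℕ; zero; suc; _∸_; _≤ᵇ_)
open import Data.Integer as ℤ using (ℤ; +_; _-_)
open import Data.Bool using (Bool; true; false; if_then_else_; _∧_)
open import Data.List using (List; []; _∷_; map; upTo; _++_)
import Data.List as L

data Step : Set where
  U D : Step

words : ℕ → List (List Step)
words zero = [] ∷ []
words (suc m) = map (U ∷_) (words m) ++ map (D ∷_) (words m)

dyckFrom : ℕ → List Step → Bool
dyckFrom zero [] = true
dyckFrom (suc h) [] = false
dyckFrom h (U ∷ w) = dyckFrom (suc h) w
dyckFrom zero (D ∷ w) = false
dyckFrom (suc h) (D ∷ w) = dyckFrom h w

isDyck : List Step → Bool
isDyck = dyckFrom 0

peakHeights : ℕ → List Step → List ℕ
peakHeights h [] = []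
peakHeights h (U ∷ D ∷ w) = suc h ∷ peakHeights (suc h) (D ∷ w)
peakHeights h (U ∷ w) = peakHeights (suc h) w
peakHeights h (D ∷ w) = peakHeights (h ∸ 1) w

countWeakLRMax : ℕ → List ℕ → ℕ
countWeakLRMax m [] = 0
countWeakLRMax m (x ∷ xs) =
  if m ≤ᵇ x then suc (countWeakLRMax x xs) else countWeakLRMax m xs

-- number of weak left to right maxima of a Dyck path (peak heights are >= 1)
weakLRMaxima : List Step → ℕ
weakLRMaxima w = countWeakLRMax 0 (peakHeights 0 w)

W : ℕ → ℕ
W n = L.foldr ℕ._+_ 0 (map (λ w → if isDyck w then weakLRMaxima w else 0) (words (n ℕ.+ n)))

PS : Set
PS = ℕ → ℤ

sumUpTo : ℕ → (ℕ → ℤ) → ℤ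
sumUpTo n f = L.foldr ℤ._+_ (+ 0) (map f (upTo (suc n)))

const : ℤ → PS
const c zero = c
const c (suc n) = + 0

𝟘 𝟙 Z : PS
𝟘 = const (+ 0)
𝟙 = const (+ 1)
Z (suc zero) = + 1
Z _ = + 0

infixl 6 _⊕_ _⊖_
infixl 7 _⊛_
infixr 8 _^^_

_⊕_ _⊖_ _⊛_ : PS → PS → PS
(f ⊕ g) n = f n ℤ.+ g n
(f ⊖ g) n = f n - g n
(f ⊛ g) n = sumUpTo n (λ k → f k ℤ.* g (n ∸ k))

_^^_ : PS → ℕ → PS
f ^^ zero = 𝟙
f ^^ suc k = f ⊛ (f ^^ k)

-- multiplicative inverse of a series with constant term 1:
-- 1/a = Σ_k (1 - a)^k, where (1 - a)^k has order >= k, so the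
-- coefficient of z^n only receives contributions from k <= n.
inv : PS → PS
inv a n = sumUpTo n (λ k → ((𝟙 ⊖ a) ^^ k) n)

sumFrom1 : ℕ → (ℕ → PS) → PS
sumFrom1 zero f = 𝟘
sumFrom1 (suc r) f = sumFrom1 r f ⊕ f (suc r)

spread : (ℕ → ℤ) → PS
spread f zero = f zero
spread f (suc zero) = + 0
spread f (suc (suc k)) = spread (λ n → f (suc n)) k

WTot : PS
WTot = spread Wc
  where
  Wc : ℕ → ℤ
  Wc zero = + 0
  Wc (suc n) = + W (suc n)

term : PS → ℕ → PS
term u r =
  (𝟙 ⊖ u) ⊛ (u ^^ r) ⊛ (𝟙 ⊖ u ^^ 2)
    ⊛ inv (𝟙 ⊖ u ^^ (1 ℕ.+ r)) ⊛ inv (𝟙 ⊖ u ^^ (2 ℕ.+ r))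
    ⊛ (const (+ 1 - + r)
       ⊕ (𝟙 ⊕ u) ⊛ sumFrom1 r (λ i → (𝟙 ⊖ u ^^ (1 ℕ.+ i)) ⊛ inv (𝟙 ⊖ u ^^ (2 ℕ.+ i))))

partialRHS : PS → ℕ → PS
partialRHS u N = sumFrom1 N (term u)

-- A weak left-to-right maximum at height j splits a Dyck path into a climb (a walk from 0 inside
-- the strip [0, j] ending with an up step onto j) and a descent from j - 1 to 0.  In generating
-- series in z the descent contributes z^(j-1) C^j, where C = 1 + u is the Catalan series in z²,
-- and the climb contributes z^j F_j ⋯ F_1, where F_m = 1/(1 - z² F_(m-1)) counts Dyck paths of
-- height at most m.  Hence WTot = Σ_j z^(2j) C^j F_1 ⋯ F_j.  Since
-- F_m = (1 + u)(1 - u^(m+1))/(1 - u^(m+2)), the r-th summand of the stated series equals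
-- (F_r - F_(r-1)) (1 + Σ_(i≤r) (F_i - 1)), and summation by parts shows that its first N summands
-- differ from Σ_(j≤N) z^(2j) C^j F_1 ⋯ F_j by (Σ_(i≤N) (F_i - 1)) (F_N - C), a multiple of
-- u^(N+1) and hence of z^(N+1).

module Submission where

open import Defs
open import Data.Nat using (ℕ; _≤_)
open import Data.Integer using (+_)
open import Data.Product using (∃-syntax; _,_)
open import Relation.Binary.PropositionalEquality using (_≡_; sym; trans)

module FiniteSum where

  open import Data.Nat as ℕ using (ℕ; zero; suc; _∸_; _<_; _≤_; z≤n; s≤s)
  import Data.Nat.Properties as ℕP
  open import Data.Integer using (ℤ; +_; _+_; _*_)
  import Data.Integer.Properties as ℤP
  open import Data.Integer.Tactic.RingSolver using (solve-∀)
  open import Data.List using (map; applyUpTo; foldr)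
  open import Data.Bool using (Bool; true; false)
  open import Function using (_∘_)
  open import Relation.Binary.PropositionalEquality
  open ≡-Reasoning

  Σ< : ℕ → (ℕ → ℤ) → ℤ
  Σ< zero f = + 0
  Σ< (suc n) f = f 0 + Σ< n (f ∘ suc)

  sumUpTo≡Σ< : ∀ n f → sumUpTo n f ≡ Σ< (suc n) f
  sumUpTo≡Σ< n f = go (suc n) (λ k → k)
    where
    go : ∀ m (g : ℕ → ℕ) → foldr _+_ (+ 0) (map f (applyUpTo g m)) ≡ Σ< m (f ∘ g)
    go zero g = refl
    go (suc m) g = cong (_+_ (f (g 0))) (go m (g ∘ suc))

  Σ<-cong-< : ∀ n {f g : ℕ → ℤ} → (∀ k → k < n → f k ≡ g k) → Σ< n f ≡ Σ< n g
  Σ<-cong-< zero eq = refl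
  Σ<-cong-< (suc n) eq = cong₂ _+_ (eq 0 (s≤s z≤n)) (Σ<-cong-< n (λ k k<n → eq (suc k) (s≤s k<n)))

  Σ<-cong : ∀ n {f g : ℕ → ℤ} → (∀ k → f k ≡ g k) → Σ< n f ≡ Σ< n g
  Σ<-cong n eq = Σ<-cong-< n (λ k _ → eq k)

  Σ<-zero : ∀ n {f : ℕ → ℤ} → (∀ k → k < n → f k ≡ + 0) → Σ< n f ≡ + 0
  Σ<-zero zero eq = refl
  Σ<-zero (suc n) eq = cong₂ _+_ (eq 0 (s≤s z≤n)) (Σ<-zero n (λ k k<n → eq (suc k) (s≤s k<n)))

  Σ<-+ : ∀ n (f g : ℕ → ℤ) → Σ< n (λ k → f k + g k) ≡ Σ< n f + Σ< n g
  Σ<-+ zero f g = refl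
  Σ<-+ (suc n) f g = trans (cong (_+_ (f 0 + g 0)) (Σ<-+ n (f ∘ suc) (g ∘ suc))) (interchange (f 0) (g 0) _ _)
    where
    interchange : ∀ a b c d → a + b + (c + d) ≡ a + c + (b + d)
    interchange = solve-∀

  Σ<-*ˡ : ∀ n c (f : ℕ → ℤ) → c * Σ< n f ≡ Σ< n (λ k → c * f k)
  Σ<-*ˡ zero c f = ℤP.*-zeroʳ c
  Σ<-*ˡ (suc n) c f = trans (ℤP.*-distribˡ-+ c (f 0) _) (cong (_+_ (c * f 0)) (Σ<-*ˡ n c (f ∘ suc)))

  Σ<-*ʳ : ∀ n c (f : ℕ → ℤ) → Σ< n f * c ≡ Σ< n (λ k → f k * c)
  Σ<-*ʳ n c f = trans (ℤP.*-comm (Σ< n f) c) (trans (Σ<-*ˡ n c f) (Σ<-cong n (λ k → ℤP.*-comm c (f k))))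

  Σ<-snoc : ∀ n (f : ℕ → ℤ) → Σ< (suc n) f ≡ Σ< n f + f n
  Σ<-snoc zero f = trans (ℤP.+-identityʳ (f 0)) (sym (ℤP.+-identityˡ (f 0)))
  Σ<-snoc (suc n) f = trans (cong (_+_ (f 0)) (Σ<-snoc n (f ∘ suc))) (sym (ℤP.+-assoc (f 0) _ _))

  Σ<-reverse : ∀ n (f : ℕ → ℤ) → Σ< n f ≡ Σ< n (λ k → f (n ∸ suc k))
  Σ<-reverse zero f = refl
  Σ<-reverse (suc n) f = begin
    f 0 + Σ< n (f ∘ suc)                          ≡⟨ cong (_+_ (f 0)) (Σ<-reverse n (f ∘ suc)) ⟩
    f 0 + Σ< n (λ k → f (suc (n ∸ suc k)))        ≡⟨ ℤP.+-comm (f 0) _ ⟩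
    Σ< n (λ k → f (suc (n ∸ suc k))) + f 0        ≡⟨ cong₂ _+_ (Σ<-cong-< n (λ k k<n → cong f (sym (ℕP.+-∸-assoc 1 k<n))))
                                                               (cong f (sym (ℕP.n∸n≡0 n))) ⟩
    Σ< n (λ k → f (suc n ∸ suc k)) + f (suc n ∸ suc n) ≡⟨ Σ<-snoc n (λ k → f (suc n ∸ suc k)) ⟨
    Σ< (suc n) (λ k → f (suc n ∸ suc k))          ∎

  Σ<-pad : ∀ m d (f : ℕ → ℤ) → (∀ k → m ≤ k → f k ≡ + 0) → Σ< (m ℕ.+ d) f ≡ Σ< m f
  Σ<-pad m zero f vanish = cong (λ x → Σ< x f) (ℕP.+-identityʳ m)
  Σ<-pad m (suc d) f vanish = begin
    Σ< (m ℕ.+ suc d) f         ≡⟨ cong (λ x → Σ< x f) (ℕP.+-suc m d) ⟩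
    Σ< (suc (m ℕ.+ d)) f       ≡⟨ Σ<-snoc (m ℕ.+ d) f ⟩
    Σ< (m ℕ.+ d) f + f (m ℕ.+ d) ≡⟨ cong₂ _+_ (Σ<-pad m d f vanish) (vanish (m ℕ.+ d) (ℕP.m≤m+n m d)) ⟩
    Σ< m f + + 0               ≡⟨ ℤP.+-identityʳ _ ⟩
    Σ< m f                     ∎

  Σ<-pad-≤ : ∀ {m n} (f : ℕ → ℤ) → m ≤ n → (∀ k → m ≤ k → f k ≡ + 0) → Σ< n f ≡ Σ< m f
  Σ<-pad-≤ {m} f m≤n vanish =
    trans (cong (λ x → Σ< x f) (sym (ℕP.m+[n∸m]≡n m≤n))) (Σ<-pad m (_ ∸ m) f vanish)

  Σ<-triangle : ∀ n (A : ℕ → ℕ → ℤ) →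
    Σ< n (λ k → Σ< (suc k) (λ j → A j k)) ≡ Σ< n (λ j → Σ< (n ∸ j) (λ i → A j (j ℕ.+ i)))
  Σ<-triangle zero A = refl
  Σ<-triangle (suc n) A = begin
    Σ< (suc n) (λ k → Σ< (suc k) (λ j → A j k))                    ≡⟨ Σ<-snoc n _ ⟩
    Σ< n (λ k → Σ< (suc k) (λ j → A j k)) + Σ< (suc n) (λ j → A j n) ≡⟨ cong (_+ Σ< (suc n) (λ j → A j n)) (Σ<-triangle n A) ⟩
    Σ< n rows + Σ< (suc n) (λ j → A j n)                           ≡⟨ cong (_+ Σ< (suc n) (λ j → A j n)) (Σ<-pad-≤ rows (ℕP.n≤1+n n) emptyRow) ⟨
    Σ< (suc n) rows + Σ< (suc n) (λ j → A j n)                     ≡⟨ Σ<-+ (suc n) rows (λ j → A j n) ⟨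
    Σ< (suc n) (λ j → rows j + A j n)                              ≡⟨ Σ<-cong-< (suc n) extendRow ⟩
    Σ< (suc n) (λ j → Σ< (suc n ∸ j) (λ i → A j (j ℕ.+ i)))        ∎
    where
    rows : ℕ → ℤ
    rows j = Σ< (n ∸ j) (λ i → A j (j ℕ.+ i))
    emptyRow : ∀ j → n ≤ j → rows j ≡ + 0
    emptyRow j n≤j = cong (λ m → Σ< m (λ i → A j (j ℕ.+ i))) (ℕP.m≤n⇒m∸n≡0 n≤j)
    extendRow : ∀ j → j < suc n → rows j + A j n ≡ Σ< (suc n ∸ j) (λ i → A j (j ℕ.+ i))
    extendRow j (s≤s j≤n) = begin
      rows j + A j n                       ≡⟨ cong (λ x → rows j + A j x) (ℕP.m+[n∸m]≡n j≤n) ⟨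
      rows j + A j (j ℕ.+ (n ∸ j))         ≡⟨ Σ<-snoc (n ∸ j) _ ⟨
      Σ< (suc (n ∸ j)) (λ i → A j (j ℕ.+ i)) ≡⟨ cong (λ x → Σ< x (λ i → A j (j ℕ.+ i))) (ℕP.+-∸-assoc 1 j≤n) ⟨
      Σ< (suc n ∸ j) (λ i → A j (j ℕ.+ i))   ∎

  ⟦_⟧ : Bool → ℤ
  ⟦ true ⟧ = + 1
  ⟦ false ⟧ = + 0

  Σ<-δ : ∀ n k (g : ℕ → ℤ) → k < n → Σ< n (λ j → ⟦ k ℕ.≡ᵇ j ⟧ * g j) ≡ g k
  Σ<-δ (suc n) zero g _ =
    trans (cong₂ _+_ (ℤP.*-identityˡ (g 0)) (Σ<-zero n (λ j _ → ℤP.*-zeroˡ (g (suc j))))) (ℤP.+-identityʳ (g 0))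
  Σ<-δ (suc n) (suc k) g (s≤s k<n) = trans (ℤP.+-identityˡ _) (Σ<-δ n k (g ∘ suc) k<n)

module PowerSeries where

  open FiniteSum
  open import Data.Nat as ℕ using (ℕ; zero; suc; _∸_; _<_; _≤_; z≤n; s≤s)
  import Data.Nat.Properties as ℕP
  open import Data.Integer as ℤ using (ℤ; +_; _+_; _*_; -_; _-_)
  import Data.Integer.Properties as ℤP
  open import Data.Maybe using (Maybe; just; nothing)
  open import Data.Product using (_,_)
  open import Data.Integer.Tactic.RingSolver using (solve-∀)
  open import Level using (0ℓ)
  open import Relation.Nullary using (yes; no)
  open import Relation.Binary.PropositionalEquality
  open import Algebra.Bundles using (CommutativeRing; RawRing)
  import Algebra.Solver.Ring as RingSolver
  open import Algebra.Solver.Ring.AlmostCommutativeRing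
    using (AlmostCommutativeRing; fromCommutativeRing; _-Raw-AlmostCommutative⟶_)
  import Relation.Binary.Reasoning.Setoid as SetoidReasoning

  infix 4 _≈_
  _≈_ : PS → PS → Set
  f ≈ g = ∀ n → f n ≡ g n

  ≈-refl : ∀ {f} → f ≈ f
  ≈-refl n = refl

  ≈-sym : ∀ {f g} → f ≈ g → g ≈ f
  ≈-sym f≈g n = sym (f≈g n)

  ≈-trans : ∀ {f g h} → f ≈ g → g ≈ h → f ≈ h
  ≈-trans f≈g g≈h n = trans (f≈g n) (g≈h n)

  𝟘-coeff : ∀ n → 𝟘 n ≡ + 0
  𝟘-coeff zero = refl
  𝟘-coeff (suc n) = refl

  ⊛-coeff : ∀ f g n → (f ⊛ g) n ≡ Σ< (suc n) (λ k → f k * g (n ∸ k))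
  ⊛-coeff f g n = sumUpTo≡Σ< n (λ k → f k * g (n ∸ k))

  ⊛-coeff₀ : ∀ f g → (f ⊛ g) 0 ≡ f 0 * g 0
  ⊛-coeff₀ f g = ℤP.+-identityʳ (f 0 * g 0)

  ⊕-cong : ∀ {f f′ g g′} → f ≈ f′ → g ≈ g′ → f ⊕ g ≈ f′ ⊕ g′
  ⊕-cong f≈f′ g≈g′ n = cong₂ _+_ (f≈f′ n) (g≈g′ n)

  ⊖-cong : ∀ {f f′ g g′} → f ≈ f′ → g ≈ g′ → f ⊖ g ≈ f′ ⊖ g′
  ⊖-cong f≈f′ g≈g′ n = cong₂ _-_ (f≈f′ n) (g≈g′ n)

  ⊛-cong : ∀ {f f′ g g′} → f ≈ f′ → g ≈ g′ → f ⊛ g ≈ f′ ⊛ g′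
  ⊛-cong {f} {f′} {g} {g′} f≈f′ g≈g′ n = begin
    (f ⊛ g) n                             ≡⟨ ⊛-coeff f g n ⟩
    Σ< (suc n) (λ k → f k * g (n ∸ k))     ≡⟨ Σ<-cong (suc n) (λ k → cong₂ _*_ (f≈f′ k) (g≈g′ (n ∸ k))) ⟩
    Σ< (suc n) (λ k → f′ k * g′ (n ∸ k))   ≡⟨ ⊛-coeff f′ g′ n ⟨
    (f′ ⊛ g′) n                           ∎
    where open ≡-Reasoning

  ⊛-comm : ∀ f g → f ⊛ g ≈ g ⊛ f
  ⊛-comm f g n = begin
    (f ⊛ g) n                                        ≡⟨ ⊛-coeff f g n ⟩
    Σ< (suc n) (λ k → f k * g (n ∸ k))                ≡⟨ Σ<-reverse (suc n) (λ k → f k * g (n ∸ k)) ⟩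
    Σ< (suc n) (λ k → f (n ∸ k) * g (n ∸ (n ∸ k)))    ≡⟨ Σ<-cong-< (suc n) swap ⟩
    Σ< (suc n) (λ k → g k * f (n ∸ k))                ≡⟨ ⊛-coeff g f n ⟨
    (g ⊛ f) n                                        ∎
    where
    open ≡-Reasoning
    swap : ∀ k → k < suc n → f (n ∸ k) * g (n ∸ (n ∸ k)) ≡ g k * f (n ∸ k)
    swap k (s≤s k≤n) = trans (ℤP.*-comm (f (n ∸ k)) _) (cong (λ i → g i * f (n ∸ k)) (ℕP.m∸[m∸n]≡n k≤n))

  ⊛-distribˡ : ∀ f g h → f ⊛ (g ⊕ h) ≈ f ⊛ g ⊕ f ⊛ h
  ⊛-distribˡ f g h n = begin
    (f ⊛ (g ⊕ h)) n                                               ≡⟨ ⊛-coeff f (g ⊕ h) n ⟩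
    Σ< (suc n) (λ k → f k * (g (n ∸ k) + h (n ∸ k)))                ≡⟨ Σ<-cong (suc n) (λ k → ℤP.*-distribˡ-+ (f k) (g (n ∸ k)) (h (n ∸ k))) ⟩
    Σ< (suc n) (λ k → f k * g (n ∸ k) + f k * h (n ∸ k))            ≡⟨ Σ<-+ (suc n) (λ k → f k * g (n ∸ k)) (λ k → f k * h (n ∸ k)) ⟩
    Σ< (suc n) (λ k → f k * g (n ∸ k)) + Σ< (suc n) (λ k → f k * h (n ∸ k)) ≡⟨ cong₂ _+_ (⊛-coeff f g n) (⊛-coeff f h n) ⟨
    (f ⊛ g ⊕ f ⊛ h) n                                             ∎
    where open ≡-Reasoning

  ⊛-distribʳ : ∀ f g h → (g ⊕ h) ⊛ f ≈ g ⊛ f ⊕ h ⊛ f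
  ⊛-distribʳ f g h =
    ≈-trans (⊛-comm (g ⊕ h) f) (≈-trans (⊛-distribˡ f g h) (⊕-cong (⊛-comm f g) (⊛-comm f h)))

  ⊛-assoc : ∀ f g h → (f ⊛ g) ⊛ h ≈ f ⊛ (g ⊛ h)
  ⊛-assoc f g h n = begin
    ((f ⊛ g) ⊛ h) n
      ≡⟨ ⊛-coeff (f ⊛ g) h n ⟩
    Σ< (suc n) (λ k → (f ⊛ g) k * h (n ∸ k))
      ≡⟨ Σ<-cong (suc n) (λ k → trans (cong (_* h (n ∸ k)) (⊛-coeff f g k)) (Σ<-*ʳ (suc k) (h (n ∸ k)) (λ j → f j * g (k ∸ j)))) ⟩
    Σ< (suc n) (λ k → Σ< (suc k) (λ j → f j * g (k ∸ j) * h (n ∸ k)))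
      ≡⟨ Σ<-triangle (suc n) (λ j k → f j * g (k ∸ j) * h (n ∸ k)) ⟩
    Σ< (suc n) (λ j → Σ< (suc n ∸ j) (λ i → f j * g (j ℕ.+ i ∸ j) * h (n ∸ (j ℕ.+ i))))
      ≡⟨ Σ<-cong-< (suc n) row ⟩
    Σ< (suc n) (λ j → f j * (g ⊛ h) (n ∸ j))
      ≡⟨ ⊛-coeff f (g ⊛ h) n ⟨
    (f ⊛ (g ⊛ h)) n ∎
    where
    open ≡-Reasoning
    row : ∀ j → j < suc n →
          Σ< (suc n ∸ j) (λ i → f j * g (j ℕ.+ i ∸ j) * h (n ∸ (j ℕ.+ i))) ≡ f j * (g ⊛ h) (n ∸ j)
    row j (s≤s j≤n) = begin
      Σ< (suc n ∸ j) entry                           ≡⟨ cong (λ m → Σ< m entry) (ℕP.+-∸-assoc 1 j≤n) ⟩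
      Σ< (suc (n ∸ j)) entry                         ≡⟨ Σ<-cong (suc (n ∸ j)) reindex ⟩
      Σ< (suc (n ∸ j)) (λ i → f j * (g i * h (n ∸ j ∸ i))) ≡⟨ Σ<-*ˡ (suc (n ∸ j)) (f j) (λ i → g i * h (n ∸ j ∸ i)) ⟨
      f j * Σ< (suc (n ∸ j)) (λ i → g i * h (n ∸ j ∸ i)) ≡⟨ cong (f j *_) (⊛-coeff g h (n ∸ j)) ⟨
      f j * (g ⊛ h) (n ∸ j)                          ∎
      where
      entry : ℕ → ℤ
      entry i = f j * g (j ℕ.+ i ∸ j) * h (n ∸ (j ℕ.+ i))
      reindex : ∀ i → entry i ≡ f j * (g i * h (n ∸ j ∸ i))
      reindex i = trans (ℤP.*-assoc (f j) _ _)
        (cong₂ (λ a b → f j * (g a * h b)) (ℕP.m+n∸m≡n j i) (sym (ℕP.∸-+-assoc n j i)))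

  const-⊛ : ∀ c f n → (const c ⊛ f) n ≡ c * f n
  const-⊛ c f n = trans (⊛-coeff (const c) f n)
    (trans (cong (_+_ (c * f n)) (Σ<-zero n (λ k _ → ℤP.*-zeroˡ (f (n ∸ suc k))))) (ℤP.+-identityʳ _))

  ⊛-identityˡ : ∀ f → 𝟙 ⊛ f ≈ f
  ⊛-identityˡ f n = trans (const-⊛ (+ 1) f n) (ℤP.*-identityˡ (f n))

  ⊛-identityʳ : ∀ f → f ⊛ 𝟙 ≈ f
  ⊛-identityʳ f = ≈-trans (⊛-comm f 𝟙) (⊛-identityˡ f)

  ring : CommutativeRing 0ℓ 0ℓ
  ring = record
    { Carrier = PS
    ; _≈_ = _≈_
    ; _+_ = _⊕_
    ; _*_ = _⊛_
    ; -_ = λ f n → - f n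
    ; 0# = 𝟘
    ; 1# = 𝟙
    ; isCommutativeRing = record
      { isRing = record
        { +-isAbelianGroup = record
          { isGroup = record
            { isMonoid = record
              { isSemigroup = record
                { isMagma = record
                  { isEquivalence = record { refl = λ {f} → ≈-refl {f} ; sym = λ {f} {g} → ≈-sym {f} {g} ; trans = λ {f} {g} {h} → ≈-trans {f} {g} {h} }
                  ; ∙-cong = λ {f} {f′} {g} {g′} → ⊕-cong {f} {f′} {g} {g′} }
                ; assoc = λ f g h n → ℤP.+-assoc (f n) (g n) (h n) }
              ; identity = (λ f n → trans (cong (_+ f n) (𝟘-coeff n)) (ℤP.+-identityˡ (f n)))
                         , (λ f n → trans (cong (_+_ (f n)) (𝟘-coeff n)) (ℤP.+-identityʳ (f n))) }
            ; inverse = (λ f n → trans (ℤP.+-inverseˡ (f n)) (sym (𝟘-coeff n)))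
                      , (λ f n → trans (ℤP.+-inverseʳ (f n)) (sym (𝟘-coeff n)))
            ; ⁻¹-cong = λ f≈g n → cong -_ (f≈g n) }
          ; comm = λ f g n → ℤP.+-comm (f n) (g n) }
        ; *-cong = λ {f} {f′} {g} {g′} → ⊛-cong {f} {f′} {g} {g′}
        ; *-assoc = ⊛-assoc
        ; *-identity = ⊛-identityˡ , ⊛-identityʳ
        ; distrib = ⊛-distribˡ , ⊛-distribʳ }
      ; *-comm = ⊛-comm }
    }

  module ≈-Reasoning = SetoidReasoning (CommutativeRing.setoid ring)

  private
    ℤ-rawRing : RawRing 0ℓ 0ℓ
    ℤ-rawRing = CommutativeRing.rawRing ℤP.+-*-commutativeRing

    PS-almostRing : AlmostCommutativeRing 0ℓ 0ℓ
    PS-almostRing = fromCommutativeRing ring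

    const-homomorphism : ℤ-rawRing -Raw-AlmostCommutative⟶ PS-almostRing
    const-homomorphism = record
      { ⟦_⟧ = const
      ; +-homo = λ { a b zero → refl ; a b (suc n) → refl }
      ; *-homo = λ { a b zero → sym (const-⊛ a (const b) zero)
                   ; a b (suc n) → sym (trans (const-⊛ a (const b) (suc n)) (ℤP.*-zeroʳ a)) }
      ; -‿homo = λ { a zero → refl ; a (suc n) → refl }
      ; 0-homo = λ n → refl
      ; 1-homo = λ n → refl }

    const-≟ : ∀ a b → Maybe (const a ≈ const b)
    const-≟ a b with a ℤ.≟ b
    ... | yes a≡b = just (λ n → cong (λ x → const x n) a≡b)
    ... | no _ = nothing

  open RingSolver ℤ-rawRing PS-almostRing const-homomorphism const-≟ public
    using (solve; _:=_; _:+_; _:*_; _:-_; con)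

  ⊕-⊛-𝟘 : ∀ {r} → r ≈ 𝟘 → ∀ x k → x ⊕ k ⊛ r ≈ x
  ⊕-⊛-𝟘 {r} r≈0 x k = ≈-trans (⊕-cong (≈-refl {x}) (⊛-cong (≈-refl {k}) r≈0))
    (solve 2 (λ a b → a :+ b :* con (+ 0) := a) (λ _ → refl) x k)

  Z⊛-suc : ∀ f n → (Z ⊛ f) (suc n) ≡ f n
  Z⊛-suc f n = begin
    (Z ⊛ f) (suc n)                                               ≡⟨ ⊛-coeff Z f (suc n) ⟩
    + 0 * f (suc n) + (+ 1 * f n + Σ< n (λ k → + 0 * f (n ∸ suc k))) ≡⟨ cong (λ x → + 0 + (+ 1 * f n + x)) (Σ<-zero n (λ k _ → refl)) ⟩
    + 0 + (+ 1 * f n + + 0)                                       ≡⟨ ℤP.+-identityˡ (+ 1 * f n + + 0) ⟩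
    + 1 * f n + + 0                                               ≡⟨ trans (ℤP.+-identityʳ (+ 1 * f n)) (ℤP.*-identityˡ (f n)) ⟩
    f n                                                           ∎
    where open ≡-Reasoning

  Z²⊛-suc-suc : ∀ f n → (Z ^^ 2 ⊛ f) (suc (suc n)) ≡ f n
  Z²⊛-suc-suc f n = begin
    (Z ^^ 2 ⊛ f) (suc (suc n))          ≡⟨ ⊛-assoc Z (Z ⊛ 𝟙) f (suc (suc n)) ⟩
    (Z ⊛ ((Z ⊛ 𝟙) ⊛ f)) (suc (suc n))   ≡⟨ Z⊛-suc ((Z ⊛ 𝟙) ⊛ f) (suc n) ⟩
    ((Z ⊛ 𝟙) ⊛ f) (suc n)               ≡⟨ ⊛-cong (⊛-identityʳ Z) (≈-refl {f}) (suc n) ⟩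
    (Z ⊛ f) (suc n)                     ≡⟨ Z⊛-suc f n ⟩
    f n                                 ∎
    where open ≡-Reasoning

  ^^-cong : ∀ {f g} → f ≈ g → ∀ k → f ^^ k ≈ g ^^ k
  ^^-cong f≈g zero = ≈-refl
  ^^-cong f≈g (suc k) = ⊛-cong f≈g (^^-cong f≈g k)

  ^^-distrib-⊛ : ∀ f g k → (f ⊛ g) ^^ k ≈ f ^^ k ⊛ g ^^ k
  ^^-distrib-⊛ f g zero = ≈-sym (⊛-identityˡ 𝟙)
  ^^-distrib-⊛ f g (suc k) = ≈-trans (⊛-cong (≈-refl {f ⊛ g}) (^^-distrib-⊛ f g k))
    (solve 4 (λ a b c d → (a :* b) :* (c :* d) := (a :* c) :* (b :* d)) (λ _ → refl) f g (f ^^ k) (g ^^ k))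

  Order≥ : ℕ → PS → Set
  Order≥ k f = ∀ n → n < k → f n ≡ + 0

  Order≥-⊛ : ∀ a b {f g} → Order≥ a f → Order≥ b g → Order≥ (a ℕ.+ b) (f ⊛ g)
  Order≥-⊛ a b {f} {g} ord-f ord-g n n<a+b = trans (⊛-coeff f g n) (Σ<-zero (suc n) vanish)
    where
    vanish : ∀ k → k < suc n → f k * g (n ∸ k) ≡ + 0
    vanish k (s≤s k≤n) with k ℕ.<? a
    ... | yes k<a = trans (cong (_* g (n ∸ k)) (ord-f k k<a)) (ℤP.*-zeroˡ (g (n ∸ k)))
    ... | no k≮a = trans (cong (f k *_) (ord-g (n ∸ k) n∸k<b)) (ℤP.*-zeroʳ (f k))
      where
      n∸k<b : n ∸ k < b
      n∸k<b = ℕP.+-cancelˡ-< k (n ∸ k) b (begin-strict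
        k ℕ.+ (n ∸ k) ≡⟨ ℕP.m+[n∸m]≡n k≤n ⟩
        n             <⟨ n<a+b ⟩
        a ℕ.+ b       ≤⟨ ℕP.+-monoˡ-≤ b (ℕP.≮⇒≥ k≮a) ⟩
        k ℕ.+ b       ∎)
        where open ℕP.≤-Reasoning

  Order≥-⊛ˡ : ∀ a {f} g → Order≥ a f → Order≥ a (f ⊛ g)
  Order≥-⊛ˡ a {f} g ord-f = subst (λ x → Order≥ x (f ⊛ g)) (ℕP.+-identityʳ a) (Order≥-⊛ a 0 ord-f (λ n ()))

  Order≥-⊛ʳ : ∀ a f {g} → Order≥ a g → Order≥ a (f ⊛ g)
  Order≥-⊛ʳ a f {g} ord-g n n<a = trans (⊛-comm f g n) (Order≥-⊛ˡ a f ord-g n n<a)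

  Order≥-weaken : ∀ {a b f} → b ≤ a → Order≥ a f → Order≥ b f
  Order≥-weaken b≤a ord-f n n<b = ord-f n (ℕP.<-≤-trans n<b b≤a)

  Order≥-resp-≈ : ∀ {a f g} → f ≈ g → Order≥ a f → Order≥ a g
  Order≥-resp-≈ f≈g ord-f n n<a = trans (sym (f≈g n)) (ord-f n n<a)

  Order≥-^^ : ∀ {f} → Order≥ 1 f → ∀ k → Order≥ k (f ^^ k)
  Order≥-^^ ord-f zero n ()
  Order≥-^^ ord-f (suc k) = Order≥-⊛ 1 k ord-f (Order≥-^^ ord-f k)

  geometric : PS → ℕ → PS
  geometric b zero = 𝟘
  geometric b (suc M) = geometric b M ⊕ b ^^ M

  geometric-coeff : ∀ b M n → geometric b M n ≡ Σ< M (λ k → (b ^^ k) n)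
  geometric-coeff b zero n = 𝟘-coeff n
  geometric-coeff b (suc M) n =
    trans (cong (_+ (b ^^ M) n) (geometric-coeff b M n)) (sym (Σ<-snoc M (λ k → (b ^^ k) n)))

  geometric-telescope : ∀ b M → (𝟙 ⊖ b) ⊛ geometric b M ≈ 𝟙 ⊖ b ^^ M
  geometric-telescope b zero = solve 1 (λ x → x :* con (+ 0) := con (+ 1) :- con (+ 1)) (λ _ → refl) (𝟙 ⊖ b)
  geometric-telescope b (suc M) = begin
    (𝟙 ⊖ b) ⊛ (geometric b M ⊕ b ^^ M)           ≈⟨ ⊛-distribˡ (𝟙 ⊖ b) (geometric b M) (b ^^ M) ⟩
    (𝟙 ⊖ b) ⊛ geometric b M ⊕ (𝟙 ⊖ b) ⊛ b ^^ M   ≈⟨ ⊕-cong (geometric-telescope b M) (≈-refl {(𝟙 ⊖ b) ⊛ b ^^ M}) ⟩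
    (𝟙 ⊖ b ^^ M) ⊕ (𝟙 ⊖ b) ⊛ b ^^ M               ≈⟨ solve 2 (λ b′ bᴹ → (con (+ 1) :- bᴹ) :+ (con (+ 1) :- b′) :* bᴹ
                                                             := con (+ 1) :- b′ :* bᴹ) (λ _ → refl) b (b ^^ M) ⟩
    𝟙 ⊖ b ⊛ b ^^ M                               ∎
    where open ≈-Reasoning

  -- Only the powers (1 - a)^k with k ≤ n contribute to the n-th coefficient.
  inv≈geometric : ∀ a n M → n < M → Order≥ 1 (𝟙 ⊖ a) → inv a n ≡ geometric (𝟙 ⊖ a) M n
  inv≈geometric a n M n<M ord = begin
    inv a n                               ≡⟨ sumUpTo≡Σ< n (λ k → ((𝟙 ⊖ a) ^^ k) n) ⟩
    Σ< (suc n) (λ k → ((𝟙 ⊖ a) ^^ k) n)    ≡⟨ Σ<-pad-≤ (λ k → ((𝟙 ⊖ a) ^^ k) n) n<M (λ k n<k → Order≥-^^ ord k n n<k) ⟨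
    Σ< M (λ k → ((𝟙 ⊖ a) ^^ k) n)          ≡⟨ geometric-coeff (𝟙 ⊖ a) M n ⟨
    geometric (𝟙 ⊖ a) M n                 ∎
    where open ≡-Reasoning

  ⊛-inverseʳ : ∀ a → a 0 ≡ + 1 → a ⊛ inv a ≈ 𝟙
  ⊛-inverseʳ a a₀≡1 n = begin
    (a ⊛ inv a) n                          ≡⟨ ⊛-coeff a (inv a) n ⟩
    Σ< (suc n) (λ k → a k * inv a (n ∸ k))  ≡⟨ Σ<-cong (suc n) (λ k → cong (a k *_)
                                                (inv≈geometric a (n ∸ k) (suc n) (s≤s (ℕP.m∸n≤m n k)) ord)) ⟩
    Σ< (suc n) (λ k → a k * G (n ∸ k))      ≡⟨ ⊛-coeff a G n ⟨
    (a ⊛ G) n                              ≡⟨ ⊛-cong a≈1-b (≈-refl {G}) n ⟩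
    ((𝟙 ⊖ b) ⊛ G) n                        ≡⟨ geometric-telescope b (suc n) n ⟩
    𝟙 n - (b ^^ suc n) n                   ≡⟨ cong (_-_ (𝟙 n)) (Order≥-^^ ord (suc n) n ℕP.≤-refl) ⟩
    𝟙 n - + 0                              ≡⟨ ℤP.+-identityʳ (𝟙 n) ⟩
    𝟙 n                                    ∎
    where
    open ≡-Reasoning
    b = 𝟙 ⊖ a
    G = geometric b (suc n)
    ord : Order≥ 1 b
    ord zero _ = cong (_-_ (+ 1)) a₀≡1
    ord (suc n) (s≤s ())
    a≈1-b : a ≈ 𝟙 ⊖ b
    a≈1-b = solve 1 (λ x → x := con (+ 1) :- (con (+ 1) :- x)) (λ _ → refl) a

  ⊛-inverseˡ : ∀ a → a 0 ≡ + 1 → inv a ⊛ a ≈ 𝟙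
  ⊛-inverseˡ a a₀≡1 = ≈-trans (⊛-comm (inv a) a) (⊛-inverseʳ a a₀≡1)

  ⊛-cancelʳ : ∀ a {f g} → a 0 ≡ + 1 → f ⊛ a ≈ g ⊛ a → f ≈ g
  ⊛-cancelʳ a {f} {g} a₀≡1 fa≈ga = begin
    f                 ≈⟨ ⊛-identityʳ f ⟨
    f ⊛ 𝟙             ≈⟨ ⊛-cong (≈-refl {f}) (⊛-inverseʳ a a₀≡1) ⟨
    f ⊛ (a ⊛ inv a)   ≈⟨ ⊛-assoc f a (inv a) ⟨
    (f ⊛ a) ⊛ inv a   ≈⟨ ⊛-cong fa≈ga (≈-refl {inv a}) ⟩
    (g ⊛ a) ⊛ inv a   ≈⟨ ⊛-assoc g a (inv a) ⟩
    g ⊛ (a ⊛ inv a)   ≈⟨ ⊛-cong (≈-refl {g}) (⊛-inverseʳ a a₀≡1) ⟩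
    g ⊛ 𝟙             ≈⟨ ⊛-identityʳ g ⟩
    g                 ∎
    where open ≈-Reasoning

  sumFrom1-cong : ∀ N {f g : ℕ → PS} → (∀ i → f (suc i) ≈ g (suc i)) → sumFrom1 N f ≈ sumFrom1 N g
  sumFrom1-cong zero eq = ≈-refl
  sumFrom1-cong (suc N) eq = ⊕-cong (sumFrom1-cong N eq) (eq N)

  ⊛-distribˡ-sumFrom1 : ∀ N c (f : ℕ → PS) → c ⊛ sumFrom1 N f ≈ sumFrom1 N (λ i → c ⊛ f i)
  ⊛-distribˡ-sumFrom1 zero c f = solve 1 (λ x → x :* con (+ 0) := con (+ 0)) (λ _ → refl) c
  ⊛-distribˡ-sumFrom1 (suc N) c f =
    ≈-trans (⊛-distribˡ c (sumFrom1 N f) (f (suc N))) (⊕-cong (⊛-distribˡ-sumFrom1 N c f) (≈-refl {c ⊛ f (suc N)}))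

  sumFrom1-coeff : ∀ N (f : ℕ → PS) n → sumFrom1 N f n ≡ Σ< N (λ i → f (suc i) n)
  sumFrom1-coeff zero f n = 𝟘-coeff n
  sumFrom1-coeff (suc N) f n =
    trans (cong (_+ f (suc N) n) (sumFrom1-coeff N f n)) (sym (Σ<-snoc N (λ i → f (suc i) n)))

  const⊛Z²⊛-injective : ∀ c {f} .{{_ : ℤ.NonZero c}} → const c ⊛ Z ^^ 2 ⊛ f ≈ 𝟘 → f ≈ 𝟘
  const⊛Z²⊛-injective c {f} cz²f≈0 n = trans (ℤP.*-cancelˡ-≡ c (f n) (+ 0) (begin
    c * f n                                ≡⟨ cong (c *_) (Z²⊛-suc-suc f n) ⟨
    c * (Z ^^ 2 ⊛ f) (suc (suc n))         ≡⟨ const-⊛ c (Z ^^ 2 ⊛ f) (suc (suc n)) ⟨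
    (const c ⊛ (Z ^^ 2 ⊛ f)) (suc (suc n)) ≡⟨ ⊛-assoc (const c) (Z ^^ 2) f (suc (suc n)) ⟨
    (const c ⊛ Z ^^ 2 ⊛ f) (suc (suc n))   ≡⟨ cz²f≈0 (suc (suc n)) ⟩
    + 0                                    ≡⟨ ℤP.*-zeroʳ c ⟨
    c * + 0                                ∎)) (sym (𝟘-coeff n))
    where open ≡-Reasoning

  Z⊛⊛-coeff : ∀ L f g → (Z ⊛ (f ⊛ g)) L ≡ Σ< L (λ a → f a * g (L ∸ suc a))
  Z⊛⊛-coeff zero f g = refl
  Z⊛⊛-coeff (suc L) f g = trans (Z⊛-suc (f ⊛ g) L) (⊛-coeff f g L)

  Order≥-cancelʳ : ∀ k a {f} → a 0 ≡ + 1 → Order≥ k (f ⊛ a) → Order≥ k f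
  Order≥-cancelʳ k a {f} a₀≡1 ord = Order≥-resp-≈ {k} {f ⊛ a ⊛ inv a} f≈ (Order≥-⊛ˡ k (inv a) ord)
    where
    f≈ : f ⊛ a ⊛ inv a ≈ f
    f≈ = ≈-trans (⊛-assoc f a (inv a)) (≈-trans (⊛-cong (≈-refl {f}) (⊛-inverseʳ a a₀≡1)) (⊛-identityʳ f))

  const-1-r⊕sumFrom1 : ∀ r (f : ℕ → PS) → const (+ 1 - + r) ⊕ sumFrom1 r f ≈ 𝟙 ⊕ sumFrom1 r (λ i → f i ⊖ 𝟙)
  const-1-r⊕sumFrom1 zero f zero = refl
  const-1-r⊕sumFrom1 zero f (suc n) = refl
  const-1-r⊕sumFrom1 (suc r) f = begin
    const (+ 1 - + suc r) ⊕ (sumFrom1 r f ⊕ f (suc r))          ≈⟨ ⊕-cong const-suc (≈-refl {sumFrom1 r f ⊕ f (suc r)}) ⟩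
    const (+ 1 - + r) ⊖ 𝟙 ⊕ (sumFrom1 r f ⊕ f (suc r))          ≈⟨ solve 3 (λ c s fᵣ → c :- con (+ 1) :+ (s :+ fᵣ) := (c :+ s) :+ (fᵣ :- con (+ 1)))
                                                                   (λ _ → refl) (const (+ 1 - + r)) (sumFrom1 r f) (f (suc r)) ⟩
    (const (+ 1 - + r) ⊕ sumFrom1 r f) ⊕ (f (suc r) ⊖ 𝟙)        ≈⟨ ⊕-cong (const-1-r⊕sumFrom1 r f) (≈-refl {f (suc r) ⊖ 𝟙}) ⟩
    𝟙 ⊕ sumFrom1 r (λ i → f i ⊖ 𝟙) ⊕ (f (suc r) ⊖ 𝟙)            ≈⟨ solve 3 (λ o g h → o :+ g :+ h := o :+ (g :+ h)) (λ _ → refl)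
                                                                   𝟙 (sumFrom1 r (λ i → f i ⊖ 𝟙)) (f (suc r) ⊖ 𝟙) ⟩
    𝟙 ⊕ sumFrom1 (suc r) (λ i → f i ⊖ 𝟙)                        ∎
    where
    open ≈-Reasoning
    const-suc : const (+ 1 - + suc r) ≈ const (+ 1 - + r) ⊖ 𝟙
    const-suc zero = shift (+ r)
      where
      shift : ∀ x → + 1 - (+ 1 + x) ≡ (+ 1 - x) - + 1
      shift = solve-∀
    const-suc (suc n) = refl

module DyckCounts where

  open FiniteSum
  open import Data.Nat as ℕ using (ℕ; zero; suc; _∸_; _≤_; _<_; z≤n; s≤s; _≤ᵇ_; _≡ᵇ_; parity)
  open import Data.Nat.GeneralisedArithmetic using (fold; iterate-is-fold)
  open import Data.Parity.Base using (0ℙ; 1ℙ)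
  import Data.Nat.Properties as ℕP
  open import Data.Integer using (ℤ; +_; _+_; _*_)
  import Data.Integer.Properties as ℤP
  open import Data.Integer.Tactic.RingSolver using (solve-∀)
  open import Data.Bool using (true; false; if_then_else_; T)
  open import Data.List using (List; []; _∷_; map; _++_; length; foldr)
  open import Data.Product using (_×_; _,_; proj₁; proj₂)
  open import Data.Unit using (tt)
  open import Function using (_∘_; _$_)
  open import Relation.Binary.PropositionalEquality
  open import Relation.Nullary using (Dec; yes; no; contradiction)
  open ≡-Reasoning

  ΣList : List (List Step) → (List Step → ℤ) → ℤ
  ΣList [] f = + 0
  ΣList (w ∷ ws) f = f w + ΣList ws f

  ΣList-++ : ∀ vs ws f → ΣList (vs ++ ws) f ≡ ΣList vs f + ΣList ws f
  ΣList-++ [] ws f = sym (ℤP.+-identityˡ _)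
  ΣList-++ (v ∷ vs) ws f = trans (cong (_+_ (f v)) (ΣList-++ vs ws f)) (sym (ℤP.+-assoc (f v) _ _))

  ΣList-map : ∀ ws (g : List Step → List Step) f → ΣList (map g ws) f ≡ ΣList ws (f ∘ g)
  ΣList-map [] g f = refl
  ΣList-map (w ∷ ws) g f = cong (_+_ (f (g w))) (ΣList-map ws g f)

  ΣList-cong : ∀ ws {f g : List Step → ℤ} → (∀ w → f w ≡ g w) → ΣList ws f ≡ ΣList ws g
  ΣList-cong [] eq = refl
  ΣList-cong (w ∷ ws) eq = cong₂ _+_ (eq w) (ΣList-cong ws eq)

  ΣList-+ : ∀ ws (f g : List Step → ℤ) → ΣList ws (λ w → f w + g w) ≡ ΣList ws f + ΣList ws g
  ΣList-+ [] f g = refl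
  ΣList-+ (w ∷ ws) f g = trans (cong (_+_ (f w + g w)) (ΣList-+ ws f g)) (interchange (f w) (g w) _ _)
    where
    interchange : ∀ a b c d → a + b + (c + d) ≡ a + c + (b + d)
    interchange = solve-∀

  ΣWords : ℕ → (List Step → ℤ) → ℤ
  ΣWords L = ΣList (words L)

  ΣWords-suc : ∀ L f → ΣWords (suc L) f ≡ ΣWords L (f ∘ (U ∷_)) + ΣWords L (f ∘ (D ∷_))
  ΣWords-suc L f = trans (ΣList-++ (map (U ∷_) (words L)) _ f)
    (cong₂ _+_ (ΣList-map (words L) (U ∷_) f) (ΣList-map (words L) (D ∷_) f))

  ΣWords-cong : ∀ L {f g} → (∀ w → f w ≡ g w) → ΣWords L f ≡ ΣWords L g
  ΣWords-cong L = ΣList-cong (words L)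

  ΣWords-vanish : ∀ L (f : List Step → ℤ) → (∀ w → length w ≡ L → f w ≡ + 0) → ΣWords L f ≡ + 0
  ΣWords-vanish zero f vanish = cong (_+ + 0) (vanish [] refl)
  ΣWords-vanish (suc L) f vanish = trans (ΣWords-suc L f) (cong₂ _+_
    (ΣWords-vanish L (f ∘ (U ∷_)) (λ w eq → vanish (U ∷ w) (cong suc eq)))
    (ΣWords-vanish L (f ∘ (D ∷_)) (λ w eq → vanish (D ∷ w) (cong suc eq))))

  below : (ℕ → ℤ) → ℕ → ℤ
  below f zero = + 0
  below f (suc h) = f h

  weakMaxima : ℕ → ℕ → List Step → ℕ
  weakMaxima h m w = if dyckFrom h w then countWeakLRMax m (peakHeights h w) else 0

  ΣweakMaxima ΣweakMaximaᵁ : ℕ → ℕ → ℕ → ℤ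
  ΣweakMaxima L h m = ΣWords L (λ w → + weakMaxima h m w)
  ΣweakMaximaᵁ L h m = ΣWords L (λ w → + weakMaxima h m (U ∷ w))

  #dyckFrom : ℕ → ℕ → ℤ
  #dyckFrom L h = ΣWords L (λ w → ⟦ dyckFrom h w ⟧)

  dyckFrom-U : ∀ h w → dyckFrom h (U ∷ w) ≡ dyckFrom (suc h) w
  dyckFrom-U zero w = refl
  dyckFrom-U (suc h) w = refl

  weakMaxima-UU : ∀ h m w → weakMaxima h m (U ∷ U ∷ w) ≡ weakMaxima (suc h) m (U ∷ w)
  weakMaxima-UU zero m w = refl
  weakMaxima-UU (suc h) m w = refl

  weakMaxima-UD : ∀ h m w → + weakMaxima h m (U ∷ D ∷ w) ≡
    (if m ≤ᵇ suc h then ⟦ dyckFrom h w ⟧ + + weakMaxima h (suc h) w else + weakMaxima h m w)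
  weakMaxima-UD h m w rewrite dyckFrom-U h (D ∷ w) with dyckFrom h w | m ≤ᵇ suc h
  ... | true  | true  = refl
  ... | true  | false = refl
  ... | false | true  = refl
  ... | false | false = refl

  ΣweakMaxima-zero : ∀ h m → ΣweakMaxima 0 h m ≡ + 0
  ΣweakMaxima-zero zero m = refl
  ΣweakMaxima-zero (suc h) m = refl

  ΣweakMaximaᵁ-zero : ∀ h m → ΣweakMaximaᵁ 0 h m ≡ + 0
  ΣweakMaximaᵁ-zero zero m = refl
  ΣweakMaximaᵁ-zero (suc h) m = refl

  ΣweakMaxima-suc : ∀ L h m → ΣweakMaxima (suc L) h m ≡ ΣweakMaximaᵁ L h m + below (λ h′ → ΣweakMaxima L h′ m) h
  ΣweakMaxima-suc L zero m = trans (ΣWords-suc L _) (cong (_+_ (ΣweakMaximaᵁ L zero m)) (ΣWords-vanish L _ (λ _ _ → refl)))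
  ΣweakMaxima-suc L (suc h) m = ΣWords-suc L _

  ΣweakMaximaᵁ-suc : ∀ L h m → ΣweakMaximaᵁ (suc L) h m ≡ ΣweakMaximaᵁ L (suc h) m
    + (if m ≤ᵇ suc h then #dyckFrom L h + ΣweakMaxima L h (suc h) else ΣweakMaxima L h m)
  ΣweakMaximaᵁ-suc L h m = trans (ΣWords-suc L (λ w → + weakMaxima h m (U ∷ w)))
    (cong₂ _+_ (ΣWords-cong L (λ w → cong +_ (weakMaxima-UU h m w)))
               (trans (ΣWords-cong L (weakMaxima-UD h m)) (peak (m ≤ᵇ suc h))))
    where
    peak : ∀ b → ΣWords L (λ w → if b then ⟦ dyckFrom h w ⟧ + + weakMaxima h (suc h) w else + weakMaxima h m w)
               ≡ (if b then #dyckFrom L h + ΣweakMaxima L h (suc h) else ΣweakMaxima L h m)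
    peak true = ΣList-+ (words L) _ _
    peak false = refl

  #dyckFrom-suc : ∀ L h → #dyckFrom (suc L) h ≡ #dyckFrom L (suc h) + below (#dyckFrom L) h
  #dyckFrom-suc L zero = trans (ΣWords-suc L _) (cong (_+_ (#dyckFrom L 1)) (ΣWords-vanish L _ (λ _ _ → refl)))
  #dyckFrom-suc L (suc h) = ΣWords-suc L _

  -- climbs j a h counts the words of length a from height h, with all peaks at height ≤ j, whose last
  -- step is an up step onto height j; climbsᵁ j a h counts those of length a + 1 that start with U.
  -- These are the prefixes that can precede a weak left-to-right maximum at height j.
  climbs climbsᵁ : ℕ → ℕ → ℕ → ℤ
  climbs j zero h = + 0
  climbs j (suc a) h = climbsᵁ j a h + below (climbs j a) h
  climbsᵁ j zero h = ⟦ suc h ≡ᵇ j ⟧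
  climbsᵁ j (suc a) h = climbsᵁ j a (suc h) + ⟦ suc h ≤ᵇ j ⟧ * climbs j a h

  -- Words of length L from height h with a marked weak maximum at height j: a prefix counted by
  -- climbs, then the descent from the peak's down step (height j - 1).
  marked markedᵁ : ℕ → ℕ → ℕ → ℤ
  marked L j h = Σ< L (λ a → climbs j a h * #dyckFrom (L ∸ suc a) (j ∸ 1))
  markedᵁ L j h = Σ< L (λ a → climbsᵁ j a h * #dyckFrom (L ∸ suc a) (j ∸ 1))

  eligible : ℕ → ℕ → ℤ
  eligible m j = ⟦ m ≤ᵇ j ⟧ * ⟦ 1 ≤ᵇ j ⟧

  byHeight byHeightᵁ : ℕ → ℕ → ℕ → ℕ → ℤ
  byHeight B L h m = Σ< B (λ j → eligible m j * marked L j h)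
  byHeightᵁ B L h m = Σ< B (λ j → eligible m j * markedᵁ L j h)

  marked-suc : ∀ L j h → marked (suc L) j h ≡ markedᵁ L j h + below (λ h′ → marked L j h′) h
  marked-suc L j zero = trans (ℤP.+-identityˡ _) (trans (Σ<-cong L (λ a →
      cong (_* #dyckFrom (L ∸ suc a) (j ∸ 1)) (ℤP.+-identityʳ (climbsᵁ j a zero)))) (sym (ℤP.+-identityʳ _)))
  marked-suc L j (suc h) = trans (ℤP.+-identityˡ _) (trans (Σ<-cong L (λ a →
      ℤP.*-distribʳ-+ (#dyckFrom (L ∸ suc a) (j ∸ 1)) (climbsᵁ j a (suc h)) (climbs j a h))) (Σ<-+ L _ _))

  markedᵁ-suc : ∀ L j h → markedᵁ (suc L) j h ≡
    ⟦ suc h ≡ᵇ j ⟧ * #dyckFrom L (j ∸ 1) + (markedᵁ L j (suc h) + ⟦ suc h ≤ᵇ j ⟧ * marked L j h)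
  markedᵁ-suc L j h = cong (_+_ (⟦ suc h ≡ᵇ j ⟧ * #dyckFrom L (j ∸ 1))) (begin
    Σ< L (λ a → (climbsᵁ j a (suc h) + c * climbs j a h) * d a)   ≡⟨ Σ<-cong L (λ a → distrib (climbsᵁ j a (suc h)) c (climbs j a h) (d a)) ⟩
    Σ< L (λ a → climbsᵁ j a (suc h) * d a + c * (climbs j a h * d a)) ≡⟨ Σ<-+ L (λ a → climbsᵁ j a (suc h) * d a) (λ a → c * (climbs j a h * d a)) ⟩
    markedᵁ L j (suc h) + Σ< L (λ a → c * (climbs j a h * d a))   ≡⟨ cong (_+_ (markedᵁ L j (suc h))) (Σ<-*ˡ L c (λ a → climbs j a h * d a)) ⟨
    markedᵁ L j (suc h) + c * marked L j h                         ∎)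
    where
    c = ⟦ suc h ≤ᵇ j ⟧
    d : ℕ → ℤ
    d a = #dyckFrom (L ∸ suc a) (j ∸ 1)
    distrib : ∀ x c y z → (x + c * y) * z ≡ x * z + c * (y * z)
    distrib = solve-∀

  ≤ᵇ-yes : ∀ {m n} → m ≤ n → (m ≤ᵇ n) ≡ true
  ≤ᵇ-yes {m} {n} m≤n with m ≤ᵇ n | ℕP.≤⇒≤ᵇ m≤n
  ... | true | _ = refl

  ≤ᵇ-no : ∀ {m n} → n < m → (m ≤ᵇ n) ≡ false
  ≤ᵇ-no {m} {n} n<m with m ≤ᵇ n in eq
  ... | false = refl
  ... | true = contradiction (ℕP.≤ᵇ⇒≤ m n (subst T (sym eq) tt)) (ℕP.<⇒≱ n<m)

  eligible-raise : ∀ {m h} j → m ≤ suc h → eligible m j * ⟦ suc h ≤ᵇ j ⟧ ≡ eligible (suc h) j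
  eligible-raise {m} {h} j m≤sh with suc h ℕ.≤? j
  ... | yes sh≤j rewrite ≤ᵇ-yes sh≤j | ≤ᵇ-yes (ℕP.≤-trans m≤sh sh≤j) = ℤP.*-identityʳ (+ 1 * ⟦ 1 ≤ᵇ j ⟧)
  ... | no sh≰j rewrite ≤ᵇ-no (ℕP.≰⇒> sh≰j) = ℤP.*-zeroʳ (eligible m j)

  eligible-keep : ∀ {m h} j → suc h < m → eligible m j * ⟦ suc h ≤ᵇ j ⟧ ≡ eligible m j
  eligible-keep {m} {h} j sh<m with suc h ℕ.≤? j
  ... | yes sh≤j rewrite ≤ᵇ-yes sh≤j = ℤP.*-identityʳ (eligible m j)
  ... | no sh≰j rewrite ≤ᵇ-no (ℕP.<-trans (ℕP.≰⇒> sh≰j) sh<m) = refl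

  byHeight-suc : ∀ B L h m → byHeight B (suc L) h m ≡ byHeightᵁ B L h m + below (λ h′ → byHeight B L h′ m) h
  byHeight-suc B L zero m = begin
    Σ< B (λ j → eligible m j * marked (suc L) j 0)                     ≡⟨ Σ<-cong B (λ j → cong (eligible m j *_) (marked-suc L j 0)) ⟩
    Σ< B (λ j → eligible m j * (markedᵁ L j 0 + + 0))                   ≡⟨ Σ<-cong B (λ j → cong (eligible m j *_) (ℤP.+-identityʳ _)) ⟩
    byHeightᵁ B L 0 m                                                  ≡⟨ ℤP.+-identityʳ _ ⟨
    byHeightᵁ B L 0 m + + 0                                            ∎
  byHeight-suc B L (suc h) m = begin
    Σ< B (λ j → eligible m j * marked (suc L) j (suc h))                ≡⟨ Σ<-cong B (λ j → trans (cong (eligible m j *_) (marked-suc L j (suc h)))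
                                                                             (ℤP.*-distribˡ-+ (eligible m j) (markedᵁ L j (suc h)) (marked L j h))) ⟩
    Σ< B (λ j → eligible m j * markedᵁ L j (suc h) + eligible m j * marked L j h)
      ≡⟨ Σ<-+ B (λ j → eligible m j * markedᵁ L j (suc h)) (λ j → eligible m j * marked L j h) ⟩
    byHeightᵁ B L (suc h) m + byHeight B L h m                          ∎

  byHeightᵁ-suc : ∀ B L h m → suc h < B → byHeightᵁ B (suc L) h m ≡ byHeightᵁ B L (suc h) m
    + (if m ≤ᵇ suc h then #dyckFrom L h + byHeight B L h (suc h) else byHeight B L h m)
  byHeightᵁ-suc B L h m sh<B = trans split (cong (_+_ (byHeightᵁ B L (suc h) m)) (peak (m ℕ.≤? suc h)))
    where
    later firstPeak raised : ℕ → ℤ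
    later j = eligible m j * markedᵁ L j (suc h)
    firstPeak j = ⟦ suc h ≡ᵇ j ⟧ * (eligible m j * #dyckFrom L (j ∸ 1))
    raised j = eligible m j * ⟦ suc h ≤ᵇ j ⟧ * marked L j h
    -- firstPeak is the case where the marked peak is the one formed by the first up step.
    split : byHeightᵁ B (suc L) h m ≡ byHeightᵁ B L (suc h) m + (eligible m (suc h) * #dyckFrom L h + Σ< B raised)
    split = begin
      Σ< B (λ j → eligible m j * markedᵁ (suc L) j h)            ≡⟨ Σ<-cong B (λ j → trans (cong (eligible m j *_) (markedᵁ-suc L j h))
                                                                      (regroup (eligible m j) ⟦ suc h ≡ᵇ j ⟧ (#dyckFrom L (j ∸ 1))
                                                                               (markedᵁ L j (suc h)) ⟦ suc h ≤ᵇ j ⟧ (marked L j h))) ⟩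
      Σ< B (λ j → later j + (firstPeak j + raised j))           ≡⟨ Σ<-+ B later (λ j → firstPeak j + raised j) ⟩
      Σ< B later + Σ< B (λ j → firstPeak j + raised j)          ≡⟨ cong (_+_ (Σ< B later)) (Σ<-+ B firstPeak raised) ⟩
      byHeightᵁ B L (suc h) m + (Σ< B firstPeak + Σ< B raised)  ≡⟨ cong (λ x → byHeightᵁ B L (suc h) m + (x + Σ< B raised))
                                                                      (Σ<-δ B (suc h) (λ j → eligible m j * #dyckFrom L (j ∸ 1)) sh<B) ⟩
      byHeightᵁ B L (suc h) m + (eligible m (suc h) * #dyckFrom L h + Σ< B raised) ∎
      where
      regroup : ∀ e δ d u c k → e * (δ * d + (u + c * k)) ≡ e * u + (δ * (e * d) + e * c * k)
      regroup = solve-∀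
    peak : Dec (m ≤ suc h) → eligible m (suc h) * #dyckFrom L h + Σ< B raised
         ≡ (if m ≤ᵇ suc h then #dyckFrom L h + byHeight B L h (suc h) else byHeight B L h m)
    peak (yes m≤sh) rewrite ≤ᵇ-yes m≤sh = cong₂ _+_ (ℤP.*-identityˡ (#dyckFrom L h))
      (Σ<-cong B (λ j → cong (_* marked L j h) (eligible-raise j m≤sh)))
    peak (no m≰sh) rewrite ≤ᵇ-no (ℕP.≰⇒> m≰sh) = trans (ℤP.+-identityˡ _)
      (Σ<-cong B (λ j → cong (_* marked L j h) (eligible-keep j (ℕP.≰⇒> m≰sh))))

  -- Each weak maximum of a word is a peak at some height j ≥ max(m, 1), preceded by a climb and followed by a descent.
  ΣweakMaxima≡byHeight : ∀ L h m B → suc (L ℕ.+ h) < B →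
    ΣweakMaxima L h m ≡ byHeight B L h m × ΣweakMaximaᵁ L h m ≡ byHeightᵁ B L h m
  ΣweakMaxima≡byHeight zero h m B _ =
    trans (ΣweakMaxima-zero h m) (sym (Σ<-zero B (λ j _ → ℤP.*-zeroʳ (eligible m j)))) ,
    trans (ΣweakMaximaᵁ-zero h m) (sym (Σ<-zero B (λ j _ → ℤP.*-zeroʳ (eligible m j))))
  ΣweakMaxima≡byHeight (suc L) h m B bound = whole , startingUp
    where
    IH : ∀ h′ m′ → L ℕ.+ h′ ≤ suc (L ℕ.+ h) →
         ΣweakMaxima L h′ m′ ≡ byHeight B L h′ m′ × ΣweakMaximaᵁ L h′ m′ ≡ byHeightᵁ B L h′ m′
    IH h′ m′ le = ΣweakMaxima≡byHeight L h′ m′ B (ℕP.≤-<-trans (s≤s le) bound)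
    whole : ΣweakMaxima (suc L) h m ≡ byHeight B (suc L) h m
    whole = begin
      ΣweakMaxima (suc L) h m                                      ≡⟨ ΣweakMaxima-suc L h m ⟩
      ΣweakMaximaᵁ L h m + below (λ h′ → ΣweakMaxima L h′ m) h     ≡⟨ cong₂ _+_ (proj₂ (IH h m (ℕP.n≤1+n _))) (lower h refl) ⟩
      byHeightᵁ B L h m + below (λ h′ → byHeight B L h′ m) h       ≡⟨ byHeight-suc B L h m ⟨
      byHeight B (suc L) h m                                       ∎
      where
      lower : ∀ h′ → h′ ≡ h → below (λ h″ → ΣweakMaxima L h″ m) h′ ≡ below (λ h″ → byHeight B L h″ m) h′
      lower zero _ = refl
      lower (suc h′) refl = proj₁ (IH h′ m (ℕP.≤-trans (ℕP.+-monoʳ-≤ L (ℕP.n≤1+n h′)) (ℕP.n≤1+n _)))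
    startingUp : ΣweakMaximaᵁ (suc L) h m ≡ byHeightᵁ B (suc L) h m
    startingUp = begin
      ΣweakMaximaᵁ (suc L) h m
        ≡⟨ ΣweakMaximaᵁ-suc L h m ⟩
      ΣweakMaximaᵁ L (suc h) m + (if m ≤ᵇ suc h then #dyckFrom L h + ΣweakMaxima L h (suc h) else ΣweakMaxima L h m)
        ≡⟨ cong₂ _+_ (proj₂ (IH (suc h) m (ℕP.≤-reflexive (ℕP.+-suc L h)))) (peak (m ≤ᵇ suc h)) ⟩
      byHeightᵁ B L (suc h) m + (if m ≤ᵇ suc h then #dyckFrom L h + byHeight B L h (suc h) else byHeight B L h m)
        ≡⟨ byHeightᵁ-suc B L h m (ℕP.≤-<-trans (s≤s (ℕP.m≤n+m h (suc L))) bound) ⟨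
      byHeightᵁ B (suc L) h m ∎
      where
      peak : ∀ b → (if b then #dyckFrom L h + ΣweakMaxima L h (suc h) else ΣweakMaxima L h m)
                 ≡ (if b then #dyckFrom L h + byHeight B L h (suc h) else byHeight B L h m)
      peak true = cong (_+_ (#dyckFrom L h)) (proj₁ (IH h (suc h) (ℕP.n≤1+n _)))
      peak false = proj₁ (IH h m (ℕP.n≤1+n _))

  dyckFrom-parity : ∀ h w → dyckFrom h w ≡ true → parity (h ℕ.+ length w) ≡ 0ℙ
  dyckFrom-parity zero [] _ = refl
  dyckFrom-parity h (U ∷ w) dyck =
    trans (cong parity (ℕP.+-suc h (length w))) (dyckFrom-parity (suc h) w (trans (sym (dyckFrom-U h w)) dyck))
  dyckFrom-parity (suc h) (D ∷ w) dyck =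
    trans (cong (parity ∘ suc) (ℕP.+-suc h (length w))) (dyckFrom-parity h w dyck)

  parity-odd : ∀ n → parity (suc (n ℕ.+ n)) ≡ 1ℙ
  parity-odd zero = refl
  parity-odd (suc n) = trans (cong (parity ∘ suc ∘ suc) (ℕP.+-suc n n)) (parity-odd n)

  ΣweakMaxima-odd : ∀ n → ΣweakMaxima (suc (n ℕ.+ n)) 0 0 ≡ + 0
  ΣweakMaxima-odd n = ΣWords-vanish (suc (n ℕ.+ n)) (λ w → + weakMaxima 0 0 w) notDyck
    where
    notDyck : ∀ w → length w ≡ suc (n ℕ.+ n) → + weakMaxima 0 0 w ≡ + 0
    notDyck w len with dyckFrom 0 w in dyck
    ... | false = refl
    ... | true with () ← trans (sym (parity-odd n)) (trans (cong parity (sym len)) (dyckFrom-parity 0 w dyck))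

  spread-even : ∀ (f : ℕ → ℤ) n → spread f (n ℕ.+ n) ≡ f n
  spread-even f zero = refl
  spread-even f (suc n) = trans (cong (spread f ∘ suc) (ℕP.+-suc n n)) (spread-even (f ∘ suc) n)

  spread-odd : ∀ (f : ℕ → ℤ) n → spread f (suc (n ℕ.+ n)) ≡ + 0
  spread-odd f zero = refl
  spread-odd f (suc n) = trans (cong (spread f ∘ suc ∘ suc) (ℕP.+-suc n n)) (spread-odd (f ∘ suc) n)

  +-foldr≡ΣList : ∀ ws (g : List Step → ℕ) → + foldr ℕ._+_ 0 (map g ws) ≡ ΣList ws (λ w → + g w)
  +-foldr≡ΣList [] g = refl
  +-foldr≡ΣList (w ∷ ws) g = trans (sym (ℤP.pos-+ (g w) _)) (cong (_+_ (+ g w)) (+-foldr≡ΣList ws g))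

  data EvenOdd : ℕ → Set where
    even : ∀ n → EvenOdd (n ℕ.+ n)
    odd : ∀ n → EvenOdd (suc (n ℕ.+ n))

  evenOdd : ∀ L → EvenOdd L
  evenOdd zero = even 0
  evenOdd (suc L) with evenOdd L
  ... | even n = odd n
  ... | odd n = subst EvenOdd (cong suc (ℕP.+-suc n n)) (even (suc n))

  WTot≡ΣweakMaxima : ∀ L → WTot L ≡ ΣweakMaxima L 0 0
  WTot≡ΣweakMaxima L = byParity (evenOdd L)
    where
    byParity : ∀ {L} → EvenOdd L → WTot L ≡ ΣweakMaxima L 0 0
    byParity (even zero) = refl
    byParity (even (suc n)) = trans (spread-even _ (suc n)) (+-foldr≡ΣList (words (suc n ℕ.+ suc n)) (weakMaxima 0 0))
    byParity (odd n) = trans (spread-odd _ n) (sym (ΣweakMaxima-odd n))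

  point : ℕ → ℕ → ℤ
  point e h = ⟦ h ≡ᵇ e ⟧

  -- One step of a walk confined to the strip [0, t], as an operator on functions of the starting height.
  stepIn : ℕ → (ℕ → ℤ) → ℕ → ℤ
  stepIn t f h = ⟦ suc h ≤ᵇ t ⟧ * f (suc h) + below f h

  -- The number of walks with a steps from height h to height e inside [0, t] (for h, e ≤ t).
  stripWalks : ℕ → ℕ → ℕ → ℕ → ℤ
  stripWalks t a h e = fold (point e) (stepIn t) a h

  stepIn-cong : ∀ t {f g : ℕ → ℤ} → (∀ k → f k ≡ g k) → ∀ h → stepIn t f h ≡ stepIn t g h
  stepIn-cong t f≡g zero = cong (λ x → ⟦ 1 ≤ᵇ t ⟧ * x + + 0) (f≡g 1)
  stepIn-cong t f≡g (suc h) = cong₂ (λ x y → ⟦ suc (suc h) ≤ᵇ t ⟧ * x + y) (f≡g (suc (suc h))) (f≡g h)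

  stepIn-agree : ∀ t {f g : ℕ → ℤ} → (∀ k → k ≤ t → f k ≡ g k) → ∀ h → h ≤ t → stepIn t f h ≡ stepIn t g h
  stepIn-agree t {f} {g} f≡g h h≤t = cong₂ _+_ up (down h h≤t)
    where
    up : ⟦ suc h ≤ᵇ t ⟧ * f (suc h) ≡ ⟦ suc h ≤ᵇ t ⟧ * g (suc h)
    up with suc h ℕ.≤? t
    ... | yes sh≤t = cong (⟦ suc h ≤ᵇ t ⟧ *_) (f≡g (suc h) sh≤t)
    ... | no sh≰t rewrite ≤ᵇ-no (ℕP.≰⇒> sh≰t) = refl
    down : ∀ h → h ≤ t → below f h ≡ below g h
    down zero _ = refl
    down (suc h) sh≤t = f≡g h (ℕP.≤-trans (ℕP.n≤1+n h) sh≤t)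

  fold-stepIn-agree : ∀ a t {f g : ℕ → ℤ} → (∀ k → k ≤ t → f k ≡ g k) →
    ∀ h → h ≤ t → fold f (stepIn t) a h ≡ fold g (stepIn t) a h
  fold-stepIn-agree zero t f≡g = f≡g
  fold-stepIn-agree (suc a) t f≡g = stepIn-agree t (fold-stepIn-agree a t f≡g)

  fold-stepIn-linear : ∀ a t c₁ c₂ (f g : ℕ → ℤ) h →
    fold (λ k → c₁ * f k + c₂ * g k) (stepIn t) a h ≡ c₁ * fold f (stepIn t) a h + c₂ * fold g (stepIn t) a h
  fold-stepIn-linear zero t c₁ c₂ f g h = refl
  fold-stepIn-linear (suc a) t c₁ c₂ f g h = trans (stepIn-cong t (fold-stepIn-linear a t c₁ c₂ f g) h) (linear h)
    where
    F = fold f (stepIn t) a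
    G = fold g (stepIn t) a
    linear : ∀ h → stepIn t (λ k → c₁ * F k + c₂ * G k) h ≡ c₁ * stepIn t F h + c₂ * stepIn t G h
    linear zero = regroup₀ ⟦ 1 ≤ᵇ t ⟧ c₁ c₂ (F 1) (G 1)
      where
      regroup₀ : ∀ i c₁ c₂ x y → i * (c₁ * x + c₂ * y) + + 0 ≡ c₁ * (i * x + + 0) + c₂ * (i * y + + 0)
      regroup₀ = solve-∀
    linear (suc h) = regroup ⟦ suc (suc h) ≤ᵇ t ⟧ c₁ c₂ (F (suc (suc h))) (G (suc (suc h))) (F h) (G h)
      where
      regroup : ∀ i c₁ c₂ x y p q → i * (c₁ * x + c₂ * y) + (c₁ * p + c₂ * q) ≡ c₁ * (i * x + p) + c₂ * (i * y + q)
      regroup = solve-∀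

  fromBelow fromAbove : ℕ → ℕ → ℤ
  fromBelow t e = ⟦ 1 ≤ᵇ e ⟧ * ⟦ e ≤ᵇ t ⟧
  fromAbove t e = ⟦ suc e ≤ᵇ t ⟧

  ≡ᵇ-refl : ∀ n → (n ≡ᵇ n) ≡ true
  ≡ᵇ-refl zero = refl
  ≡ᵇ-refl (suc n) = ≡ᵇ-refl n

  ≡ᵇ-no : ∀ {m n} → m ≢ n → (m ≡ᵇ n) ≡ false
  ≡ᵇ-no {m} {n} m≢n with m ≡ᵇ n in eq
  ... | false = refl
  ... | true = contradiction (ℕP.≡ᵇ⇒≡ m n (subst T (sym eq) tt)) m≢n

  stepIn-point : ∀ t e h → h ≤ t → stepIn t (point e) h ≡ fromBelow t e * point (e ∸ 1) h + fromAbove t e * point (suc e) h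
  stepIn-point t e h h≤t = cong₂ _+_ (up e) (down h h≤t)
    where
    up : ∀ e → ⟦ suc h ≤ᵇ t ⟧ * point e (suc h) ≡ fromBelow t e * point (e ∸ 1) h
    up zero = ℤP.*-zeroʳ ⟦ suc h ≤ᵇ t ⟧
    up (suc e) with h ℕ.≟ e
    ... | yes refl rewrite ≡ᵇ-refl h = cong (_* + 1) (sym (ℤP.*-identityˡ ⟦ suc h ≤ᵇ t ⟧))
    ... | no h≢e rewrite ≡ᵇ-no h≢e = trans (ℤP.*-zeroʳ ⟦ suc h ≤ᵇ t ⟧) (sym (ℤP.*-zeroʳ (fromBelow t (suc e))))
    down : ∀ h → h ≤ t → below (point e) h ≡ fromAbove t e * point (suc e) h
    down zero _ = sym (ℤP.*-zeroʳ (fromAbove t e))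
    down (suc h) sh≤t with h ℕ.≟ e
    ... | yes refl rewrite ≡ᵇ-refl h | ≤ᵇ-yes sh≤t = refl
    ... | no h≢e rewrite ≡ᵇ-no h≢e = sym (ℤP.*-zeroʳ (fromAbove t e))

  stripWalks-lastStep : ∀ t a h e → h ≤ t →
    stripWalks t (suc a) h e ≡ fromBelow t e * stripWalks t a h (e ∸ 1) + fromAbove t e * stripWalks t a h (suc e)
  stripWalks-lastStep t a h e h≤t = begin
    fold (point e) (stepIn t) (suc a) h
      ≡⟨ cong (_$ h) (trans (iterate-is-fold (point e) (stepIn t) (suc a)) (sym (iterate-is-fold (stepIn t (point e)) (stepIn t) a))) ⟩
    fold (stepIn t (point e)) (stepIn t) a h
      ≡⟨ fold-stepIn-agree a t (stepIn-point t e) h h≤t ⟩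
    fold (λ k → fromBelow t e * point (e ∸ 1) k + fromAbove t e * point (suc e) k) (stepIn t) a h
      ≡⟨ fold-stepIn-linear a t (fromBelow t e) (fromAbove t e) (point (e ∸ 1)) (point (suc e)) h ⟩
    fromBelow t e * stripWalks t a h (e ∸ 1) + fromAbove t e * stripWalks t a h (suc e) ∎

  climbsᵁ-vanish : ∀ j a h → j ≤ h → climbsᵁ j a h ≡ + 0
  climbsᵁ-vanish j zero h j≤h rewrite ≡ᵇ-no {suc h} {j} (λ { refl → ℕP.<-irrefl refl j≤h }) = refl
  climbsᵁ-vanish j (suc a) h j≤h rewrite climbsᵁ-vanish j a (suc h) (ℕP.m≤n⇒m≤1+n j≤h) | ≤ᵇ-no (s≤s j≤h) = refl

  -- A climb to height j is a strip walk to height j - 1 followed by an up step.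
  climbs≡stripWalks : ∀ a h j → h ≤ suc j → climbs (suc j) (suc a) h ≡ stripWalks (suc j) a h j
  climbs≡stripWalks zero zero j _ = ℤP.+-identityʳ _
  climbs≡stripWalks zero (suc h) j _ = ℤP.+-identityʳ _
  climbs≡stripWalks (suc a) h j h≤sj = cong₂ _+_ up (down h h≤sj)
    where
    up : climbsᵁ (suc j) (suc a) h ≡ ⟦ suc h ≤ᵇ suc j ⟧ * stripWalks (suc j) a (suc h) j
    up with suc h ℕ.≤? suc j
    ... | yes sh≤sj rewrite ≤ᵇ-yes sh≤sj = begin
      climbsᵁ (suc j) a (suc h) + + 1 * climbs (suc j) a h     ≡⟨ cong (_+_ (climbsᵁ (suc j) a (suc h))) (ℤP.*-identityˡ _) ⟩
      climbs (suc j) (suc a) (suc h)                          ≡⟨ climbs≡stripWalks a (suc h) j sh≤sj ⟩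
      stripWalks (suc j) a (suc h) j                          ≡⟨ ℤP.*-identityˡ _ ⟨
      + 1 * stripWalks (suc j) a (suc h) j                    ∎
    ... | no sh≰sj rewrite ≤ᵇ-no (ℕP.≰⇒> sh≰sj) =
      trans (ℤP.+-identityʳ _) (climbsᵁ-vanish (suc j) a (suc h) (ℕP.<⇒≤ (ℕP.≰⇒> sh≰sj)))
    down : ∀ h → h ≤ suc j → below (climbs (suc j) (suc a)) h ≡ below (λ k → stripWalks (suc j) a k j) h
    down zero _ = refl
    down (suc h) sh≤sj = climbs≡stripWalks a h j (ℕP.m≤n⇒m≤1+n (ℕP.≤-pred sh≤sj))

module GeneratingSeries (s u : PS)
  (s²≡1-4z² : ∀ n → (s ⊛ s) n ≡ (𝟙 ⊖ const (+ 4) ⊛ Z ^^ 2) n)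
  (2z²u≡1-2z²-s : ∀ n → (const (+ 2) ⊛ Z ^^ 2 ⊛ u) n ≡ (𝟙 ⊖ const (+ 2) ⊛ Z ^^ 2 ⊖ s) n) where

  open FiniteSum
  open PowerSeries
  open DyckCounts
  open import Data.Nat as ℕ using (ℕ; zero; suc; _∸_; _≤_; _<_; z≤n; s≤s)
  import Data.Nat.Properties as ℕP
  open import Data.Integer using (_+_; _*_; _-_)
  import Data.Integer.Properties as ℤP
  open import Data.Integer.Tactic.RingSolver using (solve-∀)
  open import Relation.Nullary using (yes; no)
  open import Data.Product using (proj₁)
  open import Relation.Binary.PropositionalEquality using (refl; sym; trans; cong; cong₂; module ≡-Reasoning)

  y : PS
  y = Z ^^ 2

  C : PS
  C = 𝟙 ⊕ u

  private
    s≈1-2yC : s ≈ 𝟙 ⊖ const (+ 2) ⊛ y ⊖ const (+ 2) ⊛ y ⊛ u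
    s≈1-2yC n = sym (trans (cong (_-_ ((𝟙 ⊖ const (+ 2) ⊛ y) n)) (2z²u≡1-2z²-s n)) (cancel ((𝟙 ⊖ const (+ 2) ⊛ y) n) (s n)))
      where
      cancel : ∀ b c → b - (b - c) ≡ c
      cancel = solve-∀

    -- Since s = 1 - 2z²C, the relation s² = 1 - 4z² says 4z²(z²C² - u) = 0.
    4y[yC²-u]≈0 : const (+ 4) ⊛ y ⊛ (y ⊛ C ⊛ C ⊖ u) ≈ 𝟘
    4y[yC²-u]≈0 = begin
      const (+ 4) ⊛ y ⊛ (y ⊛ C ⊛ C ⊖ u)
        ≈⟨ solve 2 (λ y′ u′ → con (+ 4) :* y′ :* (y′ :* (con (+ 1) :+ u′) :* (con (+ 1) :+ u′) :- u′)
                    := (con (+ 1) :- con (+ 2) :* y′ :- con (+ 2) :* y′ :* u′) :* (con (+ 1) :- con (+ 2) :* y′ :- con (+ 2) :* y′ :* u′)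
                       :- (con (+ 1) :- con (+ 4) :* y′)) (λ _ → refl) y u ⟩
      E ⊛ E ⊖ (𝟙 ⊖ const (+ 4) ⊛ y)         ≈⟨ ⊖-cong (⊛-cong (≈-sym s≈1-2yC) (≈-sym s≈1-2yC)) (≈-refl {𝟙 ⊖ const (+ 4) ⊛ y}) ⟩
      s ⊛ s ⊖ (𝟙 ⊖ const (+ 4) ⊛ y)         ≈⟨ ⊖-cong s²≡1-4z² (≈-refl {𝟙 ⊖ const (+ 4) ⊛ y}) ⟩
      (𝟙 ⊖ const (+ 4) ⊛ y) ⊖ (𝟙 ⊖ const (+ 4) ⊛ y) ≈⟨ solve 1 (λ x → x :- x := con (+ 0)) (λ _ → refl) (𝟙 ⊖ const (+ 4) ⊛ y) ⟩
      𝟘                                    ∎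
      where
      open ≈-Reasoning
      E = 𝟙 ⊖ const (+ 2) ⊛ y ⊖ const (+ 2) ⊛ y ⊛ u

  yC²≈u : y ⊛ C ⊛ C ≈ u
  yC²≈u n = ℤP.i-j≡0⇒i≡j _ _ (trans (const⊛Z²⊛-injective (+ 4) {y ⊛ C ⊛ C ⊖ u} 4y[yC²-u]≈0 n) (𝟘-coeff n))

  u-yC²≈0 : u ⊖ y ⊛ C ⊛ C ≈ 𝟘
  u-yC²≈0 = ≈-trans (⊖-cong (≈-refl {u}) yC²≈u) (solve 1 (λ a → a :- a := con (+ 0)) (λ _ → refl) u)

  y-order : Order≥ 2 y
  y-order = Order≥-^^ Z-order 2
    where
    Z-order : Order≥ 1 Z
    Z-order zero _ = refl
    Z-order (suc n) (s≤s ())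

  u-order : Order≥ 1 u
  u-order = Order≥-resp-≈ {1} {y ⊛ C ⊛ C} yC²≈u
    (Order≥-weaken {2} {1} {y ⊛ C ⊛ C} (s≤s z≤n) (Order≥-⊛ˡ 2 {y ⊛ C} C (Order≥-⊛ˡ 2 {y} C y-order)))

  C₀≡1 : C 0 ≡ + 1
  C₀≡1 = cong (_+_ (+ 1)) (u-order 0 (s≤s z≤n))

  -- A descent from height k splits at its last visits to k - 1, …, 0 into k down steps and k + 1 Dyck paths.
  descentSeries : ℕ → PS
  descentSeries k = Z ^^ k ⊛ C ^^ suc k

  descentSeries-zero : descentSeries 0 ≈ 𝟙 ⊕ Z ⊛ descentSeries 1
  descentSeries-zero = begin
    descentSeries 0   ≈⟨ solve 1 (λ u′ → con (+ 1) :* ((con (+ 1) :+ u′) :* con (+ 1)) := con (+ 1) :+ u′) (λ _ → refl) u ⟩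
    𝟙 ⊕ u             ≈⟨ ⊕-cong (≈-refl {𝟙}) (≈-sym yC²≈u) ⟩
    𝟙 ⊕ y ⊛ C ⊛ C     ≈⟨ ⊕-cong (≈-refl {𝟙}) (solve 2 (λ z c → z :* (z :* con (+ 1)) :* c :* c
                                                        := z :* ((z :* con (+ 1)) :* (c :* (c :* con (+ 1))))) (λ _ → refl) Z C) ⟩
    𝟙 ⊕ Z ⊛ descentSeries 1 ∎
    where open ≈-Reasoning

  descentSeries-suc : ∀ k → descentSeries (suc k) ≈ Z ⊛ descentSeries (suc (suc k)) ⊕ Z ⊛ descentSeries k
  descentSeries-suc k = begin
    descentSeries (suc k)
      ≈⟨ solve 4 (λ z c zᵏ cᵏ → (z :* zᵏ) :* (c :* (c :* cᵏ))
           := (z :* ((z :* (z :* zᵏ)) :* (c :* (c :* (c :* cᵏ)))) :+ z :* (zᵏ :* (c :* cᵏ)))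
              :+ (z :* zᵏ :* c :* cᵏ) :* ((c :- con (+ 1)) :- z :* (z :* con (+ 1)) :* c :* c))
           (λ _ → refl) Z C (Z ^^ k) (C ^^ k) ⟩
    (Z ⊛ descentSeries (suc (suc k)) ⊕ Z ⊛ descentSeries k) ⊕ (Z ⊛ Z ^^ k ⊛ C ⊛ C ^^ k) ⊛ (C ⊖ 𝟙 ⊖ y ⊛ C ⊛ C)
      ≈⟨ ⊕-⊛-𝟘 {C ⊖ 𝟙 ⊖ y ⊛ C ⊛ C}
           (≈-trans (solve 2 (λ u′ r → (con (+ 1) :+ u′) :- con (+ 1) :- r := u′ :- r) (λ _ → refl) u (y ⊛ C ⊛ C)) u-yC²≈0)
           (Z ⊛ descentSeries (suc (suc k)) ⊕ Z ⊛ descentSeries k) (Z ⊛ Z ^^ k ⊛ C ⊛ C ^^ k) ⟩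
    Z ⊛ descentSeries (suc (suc k)) ⊕ Z ⊛ descentSeries k ∎
    where open ≈-Reasoning

  #dyckFrom≡descentSeries : ∀ L k → #dyckFrom L k ≡ descentSeries k L
  #dyckFrom≡descentSeries zero zero =
    sym (trans (⊛-identityˡ (C ⊛ 𝟙) 0) (trans (⊛-identityʳ C 0) C₀≡1))
  #dyckFrom≡descentSeries zero (suc k) = sym (⊛-coeff₀ (Z ^^ suc k) (C ^^ suc (suc k)))
  #dyckFrom≡descentSeries (suc L) zero = begin
    #dyckFrom (suc L) 0                  ≡⟨ trans (#dyckFrom-suc L 0) (ℤP.+-identityʳ _) ⟩
    #dyckFrom L 1                        ≡⟨ #dyckFrom≡descentSeries L 1 ⟩
    descentSeries 1 L                    ≡⟨ Z⊛-suc (descentSeries 1) L ⟨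
    (Z ⊛ descentSeries 1) (suc L)        ≡⟨ ℤP.+-identityˡ _ ⟨
    (𝟙 ⊕ Z ⊛ descentSeries 1) (suc L)    ≡⟨ descentSeries-zero (suc L) ⟨
    descentSeries 0 (suc L)              ∎
    where open ≡-Reasoning
  #dyckFrom≡descentSeries (suc L) (suc k) = begin
    #dyckFrom (suc L) (suc k)                                       ≡⟨ #dyckFrom-suc L (suc k) ⟩
    #dyckFrom L (suc (suc k)) + #dyckFrom L k                       ≡⟨ cong₂ _+_ (#dyckFrom≡descentSeries L (suc (suc k))) (#dyckFrom≡descentSeries L k) ⟩
    descentSeries (suc (suc k)) L + descentSeries k L               ≡⟨ cong₂ _+_ (Z⊛-suc (descentSeries (suc (suc k))) L) (Z⊛-suc (descentSeries k) L) ⟨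
    (Z ⊛ descentSeries (suc (suc k)) ⊕ Z ⊛ descentSeries k) (suc L) ≡⟨ descentSeries-suc k (suc L) ⟨
    descentSeries (suc k) (suc L)                                   ∎
    where open ≡-Reasoning

  𝟙⊖u^_ : ℕ → PS
  𝟙⊖u^ k = 𝟙 ⊖ u ^^ k

  𝟙⊖u^suc₀ : ∀ k → (𝟙⊖u^ suc k) 0 ≡ + 1
  𝟙⊖u^suc₀ k = cong (_-_ (+ 1)) (Order≥-^^ u-order (suc k) 0 (s≤s z≤n))

  -- The series of Dyck paths of height at most m, one factor z per step: a continued fraction.
  boundedDyck : ℕ → PS
  boundedDyck zero = 𝟙
  boundedDyck (suc m) = inv (𝟙 ⊖ y ⊛ boundedDyck m)

  boundedDyck-suc : ∀ m → boundedDyck (suc m) ⊛ (𝟙 ⊖ y ⊛ boundedDyck m) ≈ 𝟙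
  boundedDyck-suc m = ⊛-inverseˡ (𝟙 ⊖ y ⊛ boundedDyck m)
    (cong (_-_ (+ 1)) (Order≥-⊛ˡ 2 {y} (boundedDyck m) y-order 0 (s≤s z≤n)))

  boundedDyck₀ : ∀ m → boundedDyck m 0 ≡ + 1
  boundedDyck₀ zero = refl
  boundedDyck₀ (suc m) = refl

  boundedDyck-closed : ∀ m → boundedDyck m ⊛ 𝟙⊖u^ (2 ℕ.+ m) ≈ C ⊛ 𝟙⊖u^ (1 ℕ.+ m)
  boundedDyck-closed zero =
    solve 1 (λ u′ → con (+ 1) :* (con (+ 1) :- u′ :* (u′ :* con (+ 1))) := (con (+ 1) :+ u′) :* (con (+ 1) :- u′ :* con (+ 1)))
      (λ _ → refl) u
  boundedDyck-closed (suc m) = begin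
    F′ ⊛ A₃                                 ≈⟨ ⊛-cong (≈-refl {F′}) (solve 2 (λ u′ p →
                                                 con (+ 1) :- u′ :* (u′ :* p) := (con (+ 1) :+ u′) :* (con (+ 1) :- u′ :* p) :- u′ :* (con (+ 1) :- p))
                                                 (λ _ → refl) u (u ^^ suc m)) ⟩
    F′ ⊛ (C ⊛ A₂ ⊖ u ⊛ A₁)                  ≈⟨ ⊛-cong (≈-refl {F′}) (⊖-cong (≈-refl {C ⊛ A₂}) (⊛-cong (≈-sym yC²≈u) (≈-refl {A₁}))) ⟩
    F′ ⊛ (C ⊛ A₂ ⊖ y ⊛ C ⊛ C ⊛ A₁)          ≈⟨ ⊛-cong (≈-refl {F′}) (⊖-cong (≈-refl {C ⊛ A₂}) (≈-trans (⊛-assoc (y ⊛ C) C A₁)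
                                                 (⊛-cong (≈-refl {y ⊛ C}) (≈-sym (boundedDyck-closed m))))) ⟩
    F′ ⊛ (C ⊛ A₂ ⊖ y ⊛ C ⊛ (F ⊛ A₂))        ≈⟨ solve 5 (λ f′ f y′ c a → f′ :* (c :* a :- y′ :* c :* (f :* a)) := (c :* a) :* (f′ :* (con (+ 1) :- y′ :* f)))
                                                 (λ _ → refl) F′ F y C A₂ ⟩
    C ⊛ A₂ ⊛ (F′ ⊛ (𝟙 ⊖ y ⊛ F))             ≈⟨ ⊛-cong (≈-refl {C ⊛ A₂}) (boundedDyck-suc m) ⟩
    C ⊛ A₂ ⊛ 𝟙                              ≈⟨ ⊛-identityʳ (C ⊛ A₂) ⟩
    C ⊛ A₂                                  ∎
    where
    open ≈-Reasoning
    F = boundedDyck m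
    F′ = boundedDyck (suc m)
    A₁ = 𝟙⊖u^ (1 ℕ.+ m)
    A₂ = 𝟙⊖u^ (2 ℕ.+ m)
    A₃ = 𝟙⊖u^ (3 ℕ.+ m)

  boundedDyck≈ : ∀ m → boundedDyck m ≈ C ⊛ 𝟙⊖u^ (1 ℕ.+ m) ⊛ inv (𝟙⊖u^ (2 ℕ.+ m))
  boundedDyck≈ m = begin
    F                  ≈⟨ ⊛-identityʳ F ⟨
    F ⊛ 𝟙              ≈⟨ ⊛-cong (≈-refl {F}) (⊛-inverseʳ A₂ (𝟙⊖u^suc₀ (suc m))) ⟨
    F ⊛ (A₂ ⊛ inv A₂)  ≈⟨ ⊛-assoc F A₂ (inv A₂) ⟨
    F ⊛ A₂ ⊛ inv A₂    ≈⟨ ⊛-cong (boundedDyck-closed m) (≈-refl {inv A₂}) ⟩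
    C ⊛ 𝟙⊖u^ (1 ℕ.+ m) ⊛ inv A₂ ∎
    where
    open ≈-Reasoning
    F = boundedDyck m
    A₂ = 𝟙⊖u^ (2 ℕ.+ m)

  boundedDyck-relation : ∀ m → boundedDyck (suc m) ⊛ (𝟙 ⊖ y ⊛ boundedDyck m) ⊖ 𝟙 ≈ 𝟘
  boundedDyck-relation m = ≈-trans (⊖-cong (boundedDyck-suc m) (≈-refl {𝟙}))
    (solve 0 (con (+ 1) :- con (+ 1) := con (+ 0)) (λ _ → refl))

  prodFDown : ℕ → ℕ → PS
  prodFDown t zero = boundedDyck t
  prodFDown t (suc e) = prodFDown t e ⊛ boundedDyck (t ∸ suc e)

  -- A walk from 0 to e in [0, t] splits at its last visits to 0, 1, …, e into e up steps and
  -- excursions confined to [k, t] for k = 0, …, e.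
  stripWalkSeries : ℕ → ℕ → PS
  stripWalkSeries t e = Z ^^ e ⊛ prodFDown t e

  stripWalkSeries₀ : ∀ t e → stripWalkSeries t e 0 ≡ point e 0
  stripWalkSeries₀ t zero = trans (⊛-identityˡ (boundedDyck t) 0) (boundedDyck₀ t)
  stripWalkSeries₀ t (suc e) = ⊛-coeff₀ (Z ^^ suc e) (prodFDown t (suc e))

  stripWalkSeries-bottom : ∀ t → stripWalkSeries (suc t) 0 ≈ 𝟙 ⊕ Z ⊛ stripWalkSeries (suc t) 1
  stripWalkSeries-bottom t = begin
    𝟙 ⊛ F′
      ≈⟨ solve 3 (λ z f′ f → con (+ 1) :* f′
           := (con (+ 1) :+ z :* ((z :* con (+ 1)) :* (f′ :* f))) :+ con (+ 1) :* (f′ :* (con (+ 1) :- z :* (z :* con (+ 1)) :* f) :- con (+ 1)))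
           (λ _ → refl) Z F′ F ⟩
    (𝟙 ⊕ Z ⊛ stripWalkSeries (suc t) 1) ⊕ 𝟙 ⊛ (F′ ⊛ (𝟙 ⊖ y ⊛ F) ⊖ 𝟙)
      ≈⟨ ⊕-⊛-𝟘 (boundedDyck-relation t) (𝟙 ⊕ Z ⊛ stripWalkSeries (suc t) 1) 𝟙 ⟩
    𝟙 ⊕ Z ⊛ stripWalkSeries (suc t) 1 ∎
    where
    open ≈-Reasoning
    F = boundedDyck t
    F′ = boundedDyck (suc t)

  stripWalkSeries-middle : ∀ t e → suc (suc e) ≤ t →
    stripWalkSeries t (suc e) ≈ Z ⊛ stripWalkSeries t e ⊕ Z ⊛ stripWalkSeries t (suc (suc e))
  stripWalkSeries-middle t e e+2≤t = begin
    stripWalkSeries t (suc e)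
      ≈⟨ solve 5 (λ z zᵉ p f f′ → (z :* zᵉ) :* (p :* f)
           := (z :* (zᵉ :* p) :+ z :* ((z :* (z :* zᵉ)) :* ((p :* f) :* f′)))
              :+ (z :* zᵉ :* p) :* (f :* (con (+ 1) :- z :* (z :* con (+ 1)) :* f′) :- con (+ 1)))
           (λ _ → refl) Z (Z ^^ e) (prodFDown t e) F F′ ⟩
    (Z ⊛ stripWalkSeries t e ⊕ Z ⊛ stripWalkSeries t (suc (suc e))) ⊕ (Z ⊛ Z ^^ e ⊛ prodFDown t e) ⊛ (F ⊛ (𝟙 ⊖ y ⊛ F′) ⊖ 𝟙)
      ≈⟨ ⊕-⊛-𝟘 relation (Z ⊛ stripWalkSeries t e ⊕ Z ⊛ stripWalkSeries t (suc (suc e))) (Z ⊛ Z ^^ e ⊛ prodFDown t e) ⟩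
    Z ⊛ stripWalkSeries t e ⊕ Z ⊛ stripWalkSeries t (suc (suc e)) ∎
    where
    open ≈-Reasoning
    F = boundedDyck (t ∸ suc e)
    F′ = boundedDyck (t ∸ suc (suc e))
    relation : F ⊛ (𝟙 ⊖ y ⊛ F′) ⊖ 𝟙 ≈ 𝟘
    relation rewrite ℕP.+-∸-assoc 1 e+2≤t = boundedDyck-relation (t ∸ suc (suc e))

  stripWalkSeries-top : ∀ e → stripWalkSeries (suc e) (suc e) ≈ Z ⊛ stripWalkSeries (suc e) e
  stripWalkSeries-top e = begin
    (Z ⊛ Z ^^ e) ⊛ (prodFDown (suc e) e ⊛ boundedDyck (e ∸ e)) ≈⟨ ⊛-cong (≈-refl {Z ⊛ Z ^^ e}) (⊛-cong (≈-refl {prodFDown (suc e) e})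
                                                                     (λ n → cong (λ k → boundedDyck k n) (ℕP.n∸n≡0 e))) ⟩
    (Z ⊛ Z ^^ e) ⊛ (prodFDown (suc e) e ⊛ 𝟙)                    ≈⟨ solve 3 (λ z zᵉ p → (z :* zᵉ) :* (p :* con (+ 1)) := z :* (zᵉ :* p))
                                                                     (λ _ → refl) Z (Z ^^ e) (prodFDown (suc e) e) ⟩
    Z ⊛ stripWalkSeries (suc e) e                                ∎
    where open ≈-Reasoning

  stripWalkSeries-lastStep : ∀ t e a → e ≤ t →
    stripWalkSeries t e (suc a) ≡ fromBelow t e * stripWalkSeries t (e ∸ 1) a + fromAbove t e * stripWalkSeries t (suc e) a
  stripWalkSeries-lastStep zero zero a _ = ⊛-identityˡ 𝟙 (suc a)
  stripWalkSeries-lastStep (suc t) zero a _ = begin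
    stripWalkSeries (suc t) 0 (suc a)                 ≡⟨ stripWalkSeries-bottom t (suc a) ⟩
    + 0 + (Z ⊛ stripWalkSeries (suc t) 1) (suc a)     ≡⟨ ℤP.+-identityˡ _ ⟩
    (Z ⊛ stripWalkSeries (suc t) 1) (suc a)           ≡⟨ Z⊛-suc (stripWalkSeries (suc t) 1) a ⟩
    stripWalkSeries (suc t) 1 a                       ≡⟨ ℤP.*-identityˡ (stripWalkSeries (suc t) 1 a) ⟨
    + 1 * stripWalkSeries (suc t) 1 a                 ≡⟨ ℤP.+-identityˡ (+ 1 * stripWalkSeries (suc t) 1 a) ⟨
    + 0 + + 1 * stripWalkSeries (suc t) 1 a           ∎
    where open ≡-Reasoning
  stripWalkSeries-lastStep t (suc e) a e<t with suc (suc e) ℕ.≤? t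
  ... | yes e+2≤t rewrite ≤ᵇ-yes e<t | ≤ᵇ-yes e+2≤t = begin
    stripWalkSeries t (suc e) (suc a)             ≡⟨ stripWalkSeries-middle t e e+2≤t (suc a) ⟩
    (Z ⊛ K e) (suc a) + (Z ⊛ K (suc (suc e))) (suc a) ≡⟨ cong₂ _+_ (Z⊛-suc (K e) a) (Z⊛-suc (K (suc (suc e))) a) ⟩
    K e a + K (suc (suc e)) a                     ≡⟨ cong₂ _+_ (ℤP.*-identityˡ (K e a)) (ℤP.*-identityˡ (K (suc (suc e)) a)) ⟨
    + 1 * K e a + + 1 * K (suc (suc e)) a         ∎
    where
    open ≡-Reasoning
    K = stripWalkSeries t
  ... | no e+2≰t with ℕP.≤-antisym e<t (ℕP.≤-pred (ℕP.≰⇒> e+2≰t))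
  ... | refl rewrite ≤ᵇ-yes (ℕP.≤-refl {suc e}) | ≤ᵇ-no (ℕP.n<1+n (suc e)) = begin
    stripWalkSeries (suc e) (suc e) (suc a)           ≡⟨ stripWalkSeries-top e (suc a) ⟩
    (Z ⊛ stripWalkSeries (suc e) e) (suc a)           ≡⟨ Z⊛-suc (stripWalkSeries (suc e) e) a ⟩
    stripWalkSeries (suc e) e a                       ≡⟨ ℤP.*-identityˡ (stripWalkSeries (suc e) e a) ⟨
    + 1 * stripWalkSeries (suc e) e a                 ≡⟨ ℤP.+-identityʳ (+ 1 * stripWalkSeries (suc e) e a) ⟨
    + 1 * stripWalkSeries (suc e) e a + + 0           ∎
    where open ≡-Reasoning

  stripWalks≡stripWalkSeries : ∀ a t e → e ≤ t → stripWalks t a 0 e ≡ stripWalkSeries t e a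
  stripWalks≡stripWalkSeries zero t e _ = sym (stripWalkSeries₀ t e)
  stripWalks≡stripWalkSeries (suc a) t e e≤t = begin
    stripWalks t (suc a) 0 e
      ≡⟨ stripWalks-lastStep t a 0 e z≤n ⟩
    fromBelow t e * stripWalks t a 0 (e ∸ 1) + fromAbove t e * stripWalks t a 0 (suc e)
      ≡⟨ cong₂ _+_ (cong (fromBelow t e *_) (stripWalks≡stripWalkSeries a t (e ∸ 1) (ℕP.≤-trans (ℕP.m∸n≤m e 1) e≤t))) above ⟩
    fromBelow t e * stripWalkSeries t (e ∸ 1) a + fromAbove t e * stripWalkSeries t (suc e) a
      ≡⟨ stripWalkSeries-lastStep t e a e≤t ⟨
    stripWalkSeries t e (suc a) ∎
    where
    open ≡-Reasoning
    above : fromAbove t e * stripWalks t a 0 (suc e) ≡ fromAbove t e * stripWalkSeries t (suc e) a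
    above with suc e ℕ.≤? t
    ... | yes e<t = cong (fromAbove t e *_) (stripWalks≡stripWalkSeries a t (suc e) e<t)
    ... | no e≮t rewrite ≤ᵇ-no (ℕP.≰⇒> e≮t) = refl

  prodF : ℕ → PS
  prodF zero = 𝟙
  prodF (suc j) = boundedDyck (suc j) ⊛ prodF j

  prodFDown⊛prodF : ∀ t e → e < t → prodFDown t e ⊛ prodF (t ∸ suc e) ≈ prodF t
  prodFDown⊛prodF (suc t) zero _ = ≈-refl
  prodFDown⊛prodF t (suc e) e+1<t = begin
    prodFDown t e ⊛ F ⊛ prodF (t ∸ suc (suc e))   ≈⟨ ⊛-assoc (prodFDown t e) F (prodF (t ∸ suc (suc e))) ⟩
    prodFDown t e ⊛ (F ⊛ prodF (t ∸ suc (suc e))) ≈⟨ ⊛-cong (≈-refl {prodFDown t e}) step ⟩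
    prodFDown t e ⊛ prodF (t ∸ suc e)             ≈⟨ prodFDown⊛prodF t e (ℕP.<-trans (ℕP.n<1+n e) e+1<t) ⟩
    prodF t                                       ∎
    where
    open ≈-Reasoning
    F = boundedDyck (t ∸ suc e)
    step : F ⊛ prodF (t ∸ suc (suc e)) ≈ prodF (t ∸ suc e)
    step rewrite ℕP.+-∸-assoc 1 e+1<t = ≈-refl

  -- The series of words with a marked weak left-to-right maximum at height j.
  markedSeries : ℕ → PS
  markedSeries j = y ^^ j ⊛ C ^^ j ⊛ prodF j

  climbs≡Z⊛stripWalkSeries : ∀ j a → climbs (suc j) a 0 ≡ (Z ⊛ stripWalkSeries (suc j) j) a
  climbs≡Z⊛stripWalkSeries j zero = refl
  climbs≡Z⊛stripWalkSeries j (suc a) = begin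
    climbs (suc j) (suc a) 0             ≡⟨ climbs≡stripWalks a 0 j z≤n ⟩
    stripWalks (suc j) a 0 j             ≡⟨ stripWalks≡stripWalkSeries a (suc j) j (ℕP.n≤1+n j) ⟩
    stripWalkSeries (suc j) j a          ≡⟨ Z⊛-suc (stripWalkSeries (suc j) j) a ⟨
    (Z ⊛ stripWalkSeries (suc j) j) (suc a) ∎
    where open ≡-Reasoning

  climb⊛descent≈markedSeries : ∀ j →
    Z ⊛ ((Z ⊛ stripWalkSeries (suc j) j) ⊛ descentSeries j) ≈ markedSeries (suc j)
  climb⊛descent≈markedSeries j = begin
    Z ⊛ ((Z ⊛ (Z ^^ j ⊛ prodFDown (suc j) j)) ⊛ (Z ^^ j ⊛ C ^^ suc j))
      ≈⟨ solve 4 (λ z zʲ p cʲ → z :* ((z :* (zʲ :* p)) :* (zʲ :* cʲ)) := ((z :* zʲ) :* (z :* zʲ)) :* cʲ :* p)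
           (λ _ → refl) Z (Z ^^ j) (prodFDown (suc j) j) (C ^^ suc j) ⟩
    (Z ^^ suc j ⊛ Z ^^ suc j) ⊛ C ^^ suc j ⊛ prodFDown (suc j) j
      ≈⟨ ⊛-cong (⊛-cong (≈-sym (^^-distrib-⊛ Z Z (suc j))) (≈-refl {C ^^ suc j})) prodFDown≈prodF ⟩
    (Z ⊛ Z) ^^ suc j ⊛ C ^^ suc j ⊛ prodF (suc j)
      ≈⟨ ⊛-cong (⊛-cong (^^-cong (⊛-cong (≈-refl {Z}) (≈-sym (⊛-identityʳ Z))) (suc j)) (≈-refl {C ^^ suc j})) (≈-refl {prodF (suc j)}) ⟩
    markedSeries (suc j) ∎
    where
    open ≈-Reasoning
    prodFDown≈prodF : prodFDown (suc j) j ≈ prodF (suc j)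
    prodFDown≈prodF = ≈-trans (≈-sym (⊛-identityʳ (prodFDown (suc j) j)))
      (≈-trans (⊛-cong (≈-refl {prodFDown (suc j) j}) (λ n → cong (λ k → prodF k n) (sym (ℕP.n∸n≡0 j))))
               (prodFDown⊛prodF (suc j) j ℕP.≤-refl))

  marked≡markedSeries : ∀ L j → marked L (suc j) 0 ≡ markedSeries (suc j) L
  marked≡markedSeries L j = begin
    Σ< L (λ a → climbs (suc j) a 0 * #dyckFrom (L ∸ suc a) j)
      ≡⟨ Σ<-cong L (λ a → cong₂ _*_ (climbs≡Z⊛stripWalkSeries j a) (#dyckFrom≡descentSeries (L ∸ suc a) j)) ⟩
    Σ< L (λ a → (Z ⊛ stripWalkSeries (suc j) j) a * descentSeries j (L ∸ suc a))
      ≡⟨ Z⊛⊛-coeff L (Z ⊛ stripWalkSeries (suc j) j) (descentSeries j) ⟨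
    (Z ⊛ ((Z ⊛ stripWalkSeries (suc j) j) ⊛ descentSeries j)) L
      ≡⟨ climb⊛descent≈markedSeries j L ⟩
    markedSeries (suc j) L ∎
    where open ≡-Reasoning

  markedSeries-order : ∀ j → Order≥ j (markedSeries j)
  markedSeries-order j = Order≥-⊛ˡ j {y ^^ j ⊛ C ^^ j} (prodF j)
    (Order≥-⊛ˡ j {y ^^ j} (C ^^ j) (Order≥-^^ (Order≥-weaken {2} {1} {y} (s≤s z≤n) y-order) j))

  WTot≡ΣmarkedSeries : ∀ N L → L ≤ N → WTot L ≡ sumFrom1 N markedSeries L
  WTot≡ΣmarkedSeries N L L≤N = begin
    WTot L                                                          ≡⟨ WTot≡ΣweakMaxima L ⟩
    ΣweakMaxima L 0 0                                               ≡⟨ proj₁ (ΣweakMaxima≡byHeight L 0 0 (2 ℕ.+ L) bound) ⟩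
    + 0 * marked L 0 0 + Σ< (suc L) (λ j → + 1 * marked L (suc j) 0) ≡⟨ ℤP.+-identityˡ _ ⟩
    Σ< (suc L) (λ j → + 1 * marked L (suc j) 0)                     ≡⟨ Σ<-cong (suc L) (λ j → trans (ℤP.*-identityˡ _) (marked≡markedSeries L j)) ⟩
    Σ< (suc L) (λ j → markedSeries (suc j) L)                       ≡⟨ Σ<-pad-≤ _ (ℕP.n≤1+n L) vanish ⟩
    Σ< L (λ j → markedSeries (suc j) L)                             ≡⟨ Σ<-pad-≤ _ L≤N vanish ⟨
    Σ< N (λ j → markedSeries (suc j) L)                             ≡⟨ sumFrom1-coeff N markedSeries L ⟨
    sumFrom1 N markedSeries L                                       ∎
    where
    open ≡-Reasoning
    bound : suc (L ℕ.+ 0) < 2 ℕ.+ L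
    bound rewrite ℕP.+-identityʳ L = ℕP.≤-refl
    vanish : ∀ j → L ≤ j → markedSeries (suc j) L ≡ + 0
    vanish j L≤j = markedSeries-order (suc j) L (s≤s L≤j)

  prodF-closed : ∀ j → prodF j ⊛ 𝟙⊖u^ (2 ℕ.+ j) ≈ C ^^ j ⊛ 𝟙⊖u^ 2
  prodF-closed zero = ≈-refl
  prodF-closed (suc j) = begin
    boundedDyck (suc j) ⊛ prodF j ⊛ 𝟙⊖u^ (3 ℕ.+ j)     ≈⟨ solve 3 (λ f p a → f :* p :* a := p :* (f :* a)) (λ _ → refl)
                                                          (boundedDyck (suc j)) (prodF j) (𝟙⊖u^ (3 ℕ.+ j)) ⟩
    prodF j ⊛ (boundedDyck (suc j) ⊛ 𝟙⊖u^ (3 ℕ.+ j))   ≈⟨ ⊛-cong (≈-refl {prodF j}) (boundedDyck-closed (suc j)) ⟩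
    prodF j ⊛ (C ⊛ 𝟙⊖u^ (2 ℕ.+ j))                     ≈⟨ solve 3 (λ p c a → p :* (c :* a) := c :* (p :* a)) (λ _ → refl)
                                                          (prodF j) C (𝟙⊖u^ (2 ℕ.+ j)) ⟩
    C ⊛ (prodF j ⊛ 𝟙⊖u^ (2 ℕ.+ j))                     ≈⟨ ⊛-cong (≈-refl {C}) (prodF-closed j) ⟩
    C ⊛ (C ^^ j ⊛ 𝟙⊖u^ 2)                              ≈⟨ ⊛-assoc C (C ^^ j) (𝟙⊖u^ 2) ⟨
    C ^^ suc j ⊛ 𝟙⊖u^ 2                                ∎
    where open ≈-Reasoning

  markedSeries-closed : ∀ j → markedSeries j ⊛ 𝟙⊖u^ (2 ℕ.+ j) ≈ u ^^ j ⊛ 𝟙⊖u^ 2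
  markedSeries-closed j = begin
    y ^^ j ⊛ C ^^ j ⊛ prodF j ⊛ 𝟙⊖u^ (2 ℕ.+ j)     ≈⟨ ⊛-assoc (y ^^ j ⊛ C ^^ j) (prodF j) (𝟙⊖u^ (2 ℕ.+ j)) ⟩
    y ^^ j ⊛ C ^^ j ⊛ (prodF j ⊛ 𝟙⊖u^ (2 ℕ.+ j))   ≈⟨ ⊛-cong (≈-refl {y ^^ j ⊛ C ^^ j}) (prodF-closed j) ⟩
    y ^^ j ⊛ C ^^ j ⊛ (C ^^ j ⊛ 𝟙⊖u^ 2)            ≈⟨ ⊛-assoc (y ^^ j ⊛ C ^^ j) (C ^^ j) (𝟙⊖u^ 2) ⟨
    y ^^ j ⊛ C ^^ j ⊛ C ^^ j ⊛ 𝟙⊖u^ 2              ≈⟨ ⊛-cong yʲC²ʲ≈uʲ (≈-refl {𝟙⊖u^ 2}) ⟩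
    u ^^ j ⊛ 𝟙⊖u^ 2                                ∎
    where
    open ≈-Reasoning
    yʲC²ʲ≈uʲ : y ^^ j ⊛ C ^^ j ⊛ C ^^ j ≈ u ^^ j
    yʲC²ʲ≈uʲ = ≈-trans (≈-sym (≈-trans (^^-distrib-⊛ (y ⊛ C) C j) (⊛-cong (^^-distrib-⊛ y C j) (≈-refl {C ^^ j}))))
                       (^^-cong yC²≈u j)

  -- Both sides of the identities below are checked after multiplying by (1 - u^(i+2))(1 - u^(i+3)).
  cancel-𝟙⊖u^ : ∀ i {f g} → f ⊛ (𝟙⊖u^ (2 ℕ.+ i) ⊛ 𝟙⊖u^ (3 ℕ.+ i)) ≈ g ⊛ (𝟙⊖u^ (2 ℕ.+ i) ⊛ 𝟙⊖u^ (3 ℕ.+ i)) → f ≈ g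
  cancel-𝟙⊖u^ i = ⊛-cancelʳ (𝟙⊖u^ (2 ℕ.+ i) ⊛ 𝟙⊖u^ (3 ℕ.+ i))
    (trans (⊛-coeff₀ (𝟙⊖u^ (2 ℕ.+ i)) (𝟙⊖u^ (3 ℕ.+ i))) (cong₂ _*_ (𝟙⊖u^suc₀ (suc i)) (𝟙⊖u^suc₀ (suc (suc i)))))

  boundedDyck-difference : ∀ i → (boundedDyck (suc i) ⊖ boundedDyck i) ⊛ (𝟙⊖u^ (2 ℕ.+ i) ⊛ 𝟙⊖u^ (3 ℕ.+ i))
                                ≈ (𝟙 ⊖ u) ⊛ u ^^ suc i ⊛ 𝟙⊖u^ 2
  boundedDyck-difference i = begin
    (F′ ⊖ F) ⊛ (A ⊛ A′)
      ≈⟨ solve 4 (λ f′ f a a′ → (f′ :- f) :* (a :* a′) := (f′ :* a′) :* a :- (f :* a) :* a′) (λ _ → refl) F′ F A A′ ⟩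
    (F′ ⊛ A′) ⊛ A ⊖ (F ⊛ A) ⊛ A′
      ≈⟨ ⊖-cong (⊛-cong (boundedDyck-closed (suc i)) (≈-refl {A})) (⊛-cong (boundedDyck-closed i) (≈-refl {A′})) ⟩
    (C ⊛ A) ⊛ A ⊖ (C ⊛ 𝟙⊖u^ (1 ℕ.+ i)) ⊛ A′
      ≈⟨ solve 2 (λ u′ p → ((con (+ 1) :+ u′) :* (con (+ 1) :- u′ :* (u′ :* p))) :* (con (+ 1) :- u′ :* (u′ :* p))
                           :- ((con (+ 1) :+ u′) :* (con (+ 1) :- u′ :* p)) :* (con (+ 1) :- u′ :* (u′ :* (u′ :* p)))
                           := (con (+ 1) :- u′) :* (u′ :* p) :* (con (+ 1) :- u′ :* (u′ :* con (+ 1)))) (λ _ → refl) u (u ^^ i) ⟩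
    (𝟙 ⊖ u) ⊛ u ^^ suc i ⊛ 𝟙⊖u^ 2      ∎
    where
    open ≈-Reasoning
    F = boundedDyck i
    F′ = boundedDyck (suc i)
    A = 𝟙⊖u^ (2 ℕ.+ i)
    A′ = 𝟙⊖u^ (3 ℕ.+ i)

  summandFactor≈ : ∀ i → (𝟙 ⊖ u) ⊛ u ^^ suc i ⊛ 𝟙⊖u^ 2 ⊛ inv (𝟙⊖u^ (2 ℕ.+ i)) ⊛ inv (𝟙⊖u^ (3 ℕ.+ i))
                        ≈ boundedDyck (suc i) ⊖ boundedDyck i
  summandFactor≈ i = cancel-𝟙⊖u^ i (begin
    Q ⊛ I ⊛ I′ ⊛ (A ⊛ A′)
      ≈⟨ solve 5 (λ q i i′ a a′ → q :* i :* i′ :* (a :* a′) := q :* ((a :* i) :* (a′ :* i′))) (λ _ → refl) Q I I′ A A′ ⟩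
    Q ⊛ ((A ⊛ I) ⊛ (A′ ⊛ I′))
      ≈⟨ ⊛-cong (≈-refl {Q}) (⊛-cong (⊛-inverseʳ A (𝟙⊖u^suc₀ (suc i))) (⊛-inverseʳ A′ (𝟙⊖u^suc₀ (suc (suc i))))) ⟩
    Q ⊛ (𝟙 ⊛ 𝟙)
      ≈⟨ solve 1 (λ q → q :* (con (+ 1) :* con (+ 1)) := q) (λ _ → refl) Q ⟩
    Q
      ≈⟨ boundedDyck-difference i ⟨
    (boundedDyck (suc i) ⊖ boundedDyck i) ⊛ (A ⊛ A′) ∎)
    where
    open ≈-Reasoning
    Q = (𝟙 ⊖ u) ⊛ u ^^ suc i ⊛ 𝟙⊖u^ 2
    A = 𝟙⊖u^ (2 ℕ.+ i)
    A′ = 𝟙⊖u^ (3 ℕ.+ i)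
    I = inv A
    I′ = inv A′

  markedSeries-suc≈ : ∀ i → markedSeries (suc i)
    ≈ (boundedDyck (suc i) ⊖ boundedDyck i) ⊕ (boundedDyck (suc i) ⊖ 𝟙) ⊛ (C ⊖ boundedDyck i)
  markedSeries-suc≈ i = cancel-𝟙⊖u^ i (begin
    markedSeries (suc i) ⊛ (A ⊛ A′)
      ≈⟨ solve 3 (λ m a a′ → m :* (a :* a′) := (m :* a′) :* a) (λ _ → refl) (markedSeries (suc i)) A A′ ⟩
    markedSeries (suc i) ⊛ A′ ⊛ A
      ≈⟨ ⊛-cong (markedSeries-closed (suc i)) (≈-refl {A}) ⟩
    u ^^ suc i ⊛ 𝟙⊖u^ 2 ⊛ A
      ≈⟨ solve 2 (λ u′ p → (u′ :* p) :* (con (+ 1) :- u′ :* (u′ :* con (+ 1))) :* (con (+ 1) :- u′ :* (u′ :* p))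
                           := (con (+ 1) :- u′) :* (u′ :* p) :* (con (+ 1) :- u′ :* (u′ :* con (+ 1)))
                              :+ ((con (+ 1) :+ u′) :* (con (+ 1) :- u′ :* (u′ :* p)) :- (con (+ 1) :- u′ :* (u′ :* (u′ :* p))))
                                 :* ((con (+ 1) :+ u′) :* (con (+ 1) :- u′ :* (u′ :* p)) :- (con (+ 1) :+ u′) :* (con (+ 1) :- u′ :* p)))
           (λ _ → refl) u (u ^^ i) ⟩
    (𝟙 ⊖ u) ⊛ u ^^ suc i ⊛ 𝟙⊖u^ 2 ⊕ (C ⊛ A ⊖ A′) ⊛ (C ⊛ A ⊖ C ⊛ 𝟙⊖u^ (1 ℕ.+ i))
      ≈⟨ ⊕-cong (≈-sym (boundedDyck-difference i))
                (⊛-cong (⊖-cong (≈-sym (boundedDyck-closed (suc i))) (≈-refl {A′})) (⊖-cong (≈-refl {C ⊛ A}) (≈-sym (boundedDyck-closed i)))) ⟩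
    (F′ ⊖ F) ⊛ (A ⊛ A′) ⊕ (F′ ⊛ A′ ⊖ A′) ⊛ (C ⊛ A ⊖ F ⊛ A)
      ≈⟨ solve 5 (λ f′ f c a a′ → (f′ :- f) :* (a :* a′) :+ (f′ :* a′ :- a′) :* (c :* a :- f :* a)
                                := ((f′ :- f) :+ (f′ :- con (+ 1)) :* (c :- f)) :* (a :* a′)) (λ _ → refl) F′ F C A A′ ⟩
    ((F′ ⊖ F) ⊕ (F′ ⊖ 𝟙) ⊛ (C ⊖ F)) ⊛ (A ⊛ A′) ∎)
    where
    open ≈-Reasoning
    F = boundedDyck i
    F′ = boundedDyck (suc i)
    A = 𝟙⊖u^ (2 ℕ.+ i)
    A′ = 𝟙⊖u^ (3 ℕ.+ i)

  excess : ℕ → PS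
  excess N = sumFrom1 N (λ i → boundedDyck i ⊖ 𝟙)

  term≈ : ∀ r → term u (suc r) ≈ (boundedDyck (suc r) ⊖ boundedDyck r) ⊛ (𝟙 ⊕ excess (suc r))
  term≈ r = ⊛-cong (summandFactor≈ r)
    (≈-trans (⊕-cong (≈-refl {const (+ 1 - + suc r)}) C⊛sum≈sumBoundedDyck) (const-1-r⊕sumFrom1 (suc r) boundedDyck))
    where
    C⊛sum≈sumBoundedDyck : C ⊛ sumFrom1 (suc r) (λ i → 𝟙⊖u^ (1 ℕ.+ i) ⊛ inv (𝟙⊖u^ (2 ℕ.+ i))) ≈ sumFrom1 (suc r) boundedDyck
    C⊛sum≈sumBoundedDyck = ≈-trans (⊛-distribˡ-sumFrom1 (suc r) C (λ i → 𝟙⊖u^ (1 ℕ.+ i) ⊛ inv (𝟙⊖u^ (2 ℕ.+ i))))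
      (sumFrom1-cong (suc r) (λ i → ≈-trans (≈-sym (⊛-assoc C (𝟙⊖u^ (2 ℕ.+ i)) (inv (𝟙⊖u^ (3 ℕ.+ i))))) (≈-sym (boundedDyck≈ (suc i)))))

  partialRHS≈ : ∀ N → partialRHS u N ≈ sumFrom1 N markedSeries ⊕ excess N ⊛ (boundedDyck N ⊖ C)
  partialRHS≈ zero = solve 1 (λ c → con (+ 0) := con (+ 0) :+ con (+ 0) :* (con (+ 1) :- c)) (λ _ → refl) C
  partialRHS≈ (suc N) = begin
    partialRHS u N ⊕ term u (suc N)
      ≈⟨ ⊕-cong (partialRHS≈ N) (term≈ N) ⟩
    (Γ ⊕ S ⊛ (F ⊖ C)) ⊕ (F′ ⊖ F) ⊛ (𝟙 ⊕ (S ⊕ (F′ ⊖ 𝟙)))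
      ≈⟨ solve 5 (λ γ s f f′ c → (γ :+ s :* (f :- c)) :+ (f′ :- f) :* (con (+ 1) :+ (s :+ (f′ :- con (+ 1))))
                               := (γ :+ ((f′ :- f) :+ (f′ :- con (+ 1)) :* (c :- f))) :+ (s :+ (f′ :- con (+ 1))) :* (f′ :- c))
           (λ _ → refl) Γ S F F′ C ⟩
    (Γ ⊕ ((F′ ⊖ F) ⊕ (F′ ⊖ 𝟙) ⊛ (C ⊖ F))) ⊕ excess (suc N) ⊛ (F′ ⊖ C)
      ≈⟨ ⊕-cong (⊕-cong (≈-refl {Γ}) (≈-sym (markedSeries-suc≈ N))) (≈-refl {excess (suc N) ⊛ (F′ ⊖ C)}) ⟩
    sumFrom1 (suc N) markedSeries ⊕ excess (suc N) ⊛ (F′ ⊖ C) ∎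
    where
    open ≈-Reasoning
    Γ = sumFrom1 N markedSeries
    S = excess N
    F = boundedDyck N
    F′ = boundedDyck (suc N)

  boundedDyck⊖C-order : ∀ N → Order≥ (suc N) (boundedDyck N ⊖ C)
  boundedDyck⊖C-order N = Order≥-cancelʳ (suc N) (𝟙⊖u^ (2 ℕ.+ N)) (𝟙⊖u^suc₀ (suc N))
    (Order≥-resp-≈ {suc N} {u ^^ suc N ⊛ (C ⊛ (u ⊖ 𝟙))} (≈-sym difference)
      (Order≥-⊛ˡ (suc N) (C ⊛ (u ⊖ 𝟙)) (Order≥-^^ u-order (suc N))))
    where
    open ≈-Reasoning
    difference : (boundedDyck N ⊖ C) ⊛ 𝟙⊖u^ (2 ℕ.+ N) ≈ u ^^ suc N ⊛ (C ⊛ (u ⊖ 𝟙))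
    difference = begin
      (boundedDyck N ⊖ C) ⊛ 𝟙⊖u^ (2 ℕ.+ N)                  ≈⟨ solve 3 (λ f c a → (f :- c) :* a := f :* a :- c :* a) (λ _ → refl)
                                                               (boundedDyck N) C (𝟙⊖u^ (2 ℕ.+ N)) ⟩
      boundedDyck N ⊛ 𝟙⊖u^ (2 ℕ.+ N) ⊖ C ⊛ 𝟙⊖u^ (2 ℕ.+ N)   ≈⟨ ⊖-cong (boundedDyck-closed N) (≈-refl {C ⊛ 𝟙⊖u^ (2 ℕ.+ N)}) ⟩
      C ⊛ 𝟙⊖u^ (1 ℕ.+ N) ⊖ C ⊛ 𝟙⊖u^ (2 ℕ.+ N)               ≈⟨ solve 3 (λ u′ p c → c :* (con (+ 1) :- p) :- c :* (con (+ 1) :- u′ :* p)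
                                                                              := p :* (c :* (u′ :- con (+ 1)))) (λ _ → refl) u (u ^^ suc N) C ⟩
      u ^^ suc N ⊛ (C ⊛ (u ⊖ 𝟙))                            ∎

  partialRHS≡ΣmarkedSeries : ∀ N n → n ≤ N → partialRHS u N n ≡ sumFrom1 N markedSeries n
  partialRHS≡ΣmarkedSeries N n n≤N = trans (partialRHS≈ N n) (trans (cong (_+_ (sumFrom1 N markedSeries n)) vanish) (ℤP.+-identityʳ _))
    where
    vanish : (excess N ⊛ (boundedDyck N ⊖ C)) n ≡ + 0
    vanish = Order≥-⊛ʳ (suc N) (excess N) (boundedDyck⊖C-order N) n (s≤s n≤N)

theorem7 : (s u : PS)
    → s 0 ≡ + 1
    → (∀ n → (s ⊛ s) n ≡ (𝟙 ⊖ const (+ 4) ⊛ Z ^^ 2) n)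
    → (∀ n → (const (+ 2) ⊛ Z ^^ 2 ⊛ u) n ≡ (𝟙 ⊖ const (+ 2) ⊛ Z ^^ 2 ⊖ s) n)
    → ∀ n → ∃[ N₀ ] (∀ N → N₀ ≤ N → WTot n ≡ partialRHS u N n)
theorem7 s u _ s² 2z²u n = n , λ N n≤N →
  trans (WTot≡ΣmarkedSeries N n n≤N) (sym (partialRHS≡ΣmarkedSeries N n n≤N))
  where open GeneratingSeries s u s² 2z²u
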